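{- For every integer $m\geq1$, \[ \sum_{j=1}^{m-1}[\delta_{j},\partial_{m-j}]=(m-1)(\partial_{m}+\delta_{m}) \] as maps $\mathfrak{h}\to\mathfrak{h}$, where $[A,B]=AB-BA$ (composition).
   Context: $\mathfrak{h}=\mathbb{Q}\langle x,y\rangle$. For $m\ge1$, $\delta_m$ and $\partial_m$ are the derivations of $\mathfrak{h}$ determined by $\delta_{m}(x)=0$, $\delta_{m}(y)=yx^{m-1}(x+y)$, $\partial_{m}(x)=y(x+y)^{m-1}x$, $\partial_{m}(y)=-y(x+y)^{m-1}x$. -}

module Defs where

-- The free associative algebra h = ℚ⟨x,y⟩, represented by (non-normalised)
-- finite formal ℚ-linear combinations of words in the letters x, y.

open import Data.Nat using (ℕ; zero; suc; _∸_)
open import Data.Rational using (ℚ; 0ℚ; 1ℚ; -_) renaming (_+_ to _+ℚ_; _*_ to _*ℚ_)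
open import Data.Integer using (+_)
open import Data.Rational using (_/_)
open import Data.List using (List; []; _∷_; _++_; map; concatMap)
open import Data.Product using (_×_; _,_)
open import Data.Bool using (if_then_else_)
open import Relation.Nullary.Decidable using (⌊_⌋)
open import Relation.Binary.PropositionalEquality using (_≡_; refl)
open import Relation.Nullary using (Dec; yes; no)

data Letter : Set where
  X Y : Letter

Word : Set
Word = List Letter

_≟L_ : (a b : Letter) → Dec (a ≡ b)
X ≟L X = yes refl
X ≟L Y = no (λ ())
Y ≟L X = no (λ ())
Y ≟L Y = yes refl

_≟W_ : (u v : Word) → Dec (u ≡ v)
[] ≟W [] = yes refl
[] ≟W (_ ∷ _) = no (λ ())
(_ ∷ _) ≟W [] = no (λ ())
(a ∷ u) ≟W (b ∷ v) with a ≟L b | u ≟W v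
... | yes refl | yes refl = yes refl
... | no a≢b | _ = no (λ { refl → a≢b refl })
... | yes _ | no u≢v = no (λ { refl → u≢v refl })

H : Set
H = List (ℚ × Word)

coeff : H → Word → ℚ
coeff [] w = 0ℚ
coeff ((c , u) ∷ p) w = (if ⌊ u ≟W w ⌋ then c else 0ℚ) +ℚ coeff p w

_≈_ : H → H → Set
p ≈ q = ∀ w → coeff p w ≡ coeff q w

infix 4 _≈_
infixl 6 _⊕_ _⊖_
infixl 7 _⊗_ _·_

zeroH : H
zeroH = []

_⊕_ : H → H → H
p ⊕ q = p ++ q

_·_ : ℚ → H → H
c · p = map (λ { (d , u) → (c *ℚ d , u) }) p

_⊖_ : H → H → H
p ⊖ q = p ⊕ ((- 1ℚ) · q)

_⊗_ : H → H → H
p ⊗ q = concatMap (λ { (c , u) → map (λ { (d , v) → (c *ℚ d , u ++ v) }) q }) p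

oneH : H
oneH = (1ℚ , []) ∷ []

x y : H
x = (1ℚ , X ∷ []) ∷ []
y = (1ℚ , Y ∷ []) ∷ []

_^_ : H → ℕ → H
p ^ zero = oneH
p ^ suc n = p ⊗ (p ^ n)

wordH : Word → H
wordH w = (1ℚ , w) ∷ []

ℕtoℚ : ℕ → ℚ
ℕtoℚ n = + n / 1

derOnWord : H → H → Word → H
derOnWord dx dy [] = zeroH
derOnWord dx dy (X ∷ w) = (dx ⊗ wordH w) ⊕ (wordH (X ∷ []) ⊗ derOnWord dx dy w)
derOnWord dx dy (Y ∷ w) = (dy ⊗ wordH w) ⊕ (wordH (Y ∷ []) ⊗ derOnWord dx dy w)

derivation : H → H → H → H
derivation dx dy p = concatMap (λ { (c , w) → c · derOnWord dx dy w }) p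

δ : ℕ → H → H
δ m = derivation zeroH (y ⊗ (x ^ (m ∸ 1)) ⊗ (x ⊕ y))

∂ : ℕ → H → H
∂ m = derivation (y ⊗ ((x ⊕ y) ^ (m ∸ 1)) ⊗ x) ((- 1ℚ) · (y ⊗ ((x ⊕ y) ^ (m ∸ 1)) ⊗ x))

⟦_,_⟧ : (H → H) → (H → H) → H → H
⟦ A , B ⟧ p = A (B p) ⊖ B (A p)

sumFrom1 : ℕ → (ℕ → H → H) → H → H
sumFrom1 zero f p = zeroH
sumFrom1 (suc n) f p = sumFrom1 n f p ⊕ f (suc n) p

{-# OPTIONS --safe #-}
-- Both sides are derivations of h (the left one as a sum of commutators of derivations), and a
-- derivation is determined by its values on x and y, so it suffices to compare them there.
-- Write S = x + y. Then δ_j S = y x^(j-1) S and ∂_k S = 0, and the Leibniz rule on powers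
-- (D (A^n) = Σ A^a (D A) A^(n-1-a)) exhibits [δ_j, ∂_(m-j)] x and [δ_j, ∂_(m-j)] y as differences
-- of consecutive members of explicit families of such insertion sums. Summed over j they telescope,
-- and the end terms are (m-1) y S^(m-1) x = (m-1) ∂_m x and (m-1) (y x^(m-1) S - y S^(m-1) x).
module Submission where

open import Defs
open import Data.Nat using (ℕ; zero; suc; _≤_; _<_; _∸_; z≤n; s≤s)
import Data.Nat as ℕ
import Data.Nat.Properties as ℕ
open import Data.Rational using (ℚ; 0ℚ; 1ℚ; _+_; _*_; -_; _≟_; toℚᵘ)
open import Data.Rational.Properties
  using (+-identityˡ; +-identityʳ; +-assoc; +-inverseʳ; *-zeroˡ; *-zeroʳ;
         *-distribˡ-+; *-distribʳ-+; *-assoc; *-comm; *-identityˡ; *-identityʳ)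
open import Data.Rational.Solver using (module +-*-Solver)
import Data.Rational.Properties as ℚ
open import Data.Rational.Unnormalised using (mkℚᵘ; *≡*)
import Data.Rational.Unnormalised as ℚᵘ
import Data.Rational.Unnormalised.Properties as ℚᵘ
import Data.Integer as ℤ
import Data.Integer.Solver
open import Data.List using (List; []; _∷_; _++_; map; length)
import Data.List.Properties as List
open import Data.List.Relation.Unary.All using (All; []; _∷_; universal)
open import Data.List.Relation.Unary.All.Properties using (++⁺)
open import Data.Product using (_×_; _,_; proj₂)
open import Data.Bool using (if_then_else_)
open import Data.Empty using (⊥-elim)
open import Relation.Binary.PropositionalEquality
open import Relation.Binary.Bundles using (Setoid)
import Relation.Binary.Reasoning.Setoid
open import Relation.Binary.Definitions using (tri<; tri≈; tri>)
open import Relation.Nullary using (yes; no; ¬_)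
open import Relation.Nullary.Decidable using (⌊_⌋)

open +-*-Solver using (solve; _:+_; _:*_; _:=_)

termCoeff : Word → ℚ → Word → ℚ
termCoeff u c w = if ⌊ u ≟W w ⌋ then c else 0ℚ

termCoeff-∷ : ∀ a u c z → termCoeff (a ∷ u) c (a ∷ z) ≡ termCoeff u c z
termCoeff-∷ X u c z with u ≟W z
... | yes refl = refl
... | no _     = refl
termCoeff-∷ Y u c z with u ≟W z
... | yes refl = refl
... | no _     = refl

termCoeff-∷-≢ : ∀ {a b} → ¬ a ≡ b → ∀ u c z → termCoeff (a ∷ u) c (b ∷ z) ≡ 0ℚ
termCoeff-∷-≢ {X} {X} a≢b u c z = ⊥-elim (a≢b refl)
termCoeff-∷-≢ {X} {Y} a≢b u c z = refl
termCoeff-∷-≢ {Y} {X} a≢b u c z = refl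
termCoeff-∷-≢ {Y} {Y} a≢b u c z = ⊥-elim (a≢b refl)

termCoeff-* : ∀ u c d w → termCoeff u (c * d) w ≡ c * termCoeff u d w
termCoeff-* u c d w with u ≟W w
... | yes _ = refl
... | no _  = sym (*-zeroʳ c)

coeff-++ : ∀ p q w → coeff (p ++ q) w ≡ coeff p w + coeff q w
coeff-++ []            q w = sym (+-identityˡ _)
coeff-++ ((c , u) ∷ p) q w =
  trans (cong (termCoeff u c w +_) (coeff-++ p q w)) (sym (+-assoc (termCoeff u c w) _ _))

coeff-· : ∀ c p w → coeff (c · p) w ≡ c * coeff p w
coeff-· c []            w = sym (*-zeroʳ c)
coeff-· c ((d , u) ∷ p) w =
  trans (cong₂ _+_ (termCoeff-* u c d w) (coeff-· c p w)) (sym (*-distribˡ-+ c _ _))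

-- (f ⋆ g) w is the sum of f u * g v over all factorisations w = u ++ v,
-- enumerated by peeling letters off the front of w into u.
infixl 7 _⋆_
_⋆_ : (Word → ℚ) → (Word → ℚ) → Word → ℚ
(f ⋆ g) []      = f [] * g []
(f ⋆ g) (a ∷ w) = f [] * g (a ∷ w) + ((λ z → f (a ∷ z)) ⋆ g) w

⋆-cong : ∀ {f f′ g g′} → (∀ z → f z ≡ f′ z) → (∀ z → g z ≡ g′ z) → ∀ w → (f ⋆ g) w ≡ (f′ ⋆ g′) w
⋆-cong f≗f′ g≗g′ []      = cong₂ _*_ (f≗f′ []) (g≗g′ [])
⋆-cong f≗f′ g≗g′ (a ∷ w) =
  cong₂ _+_ (cong₂ _*_ (f≗f′ []) (g≗g′ (a ∷ w))) (⋆-cong (λ z → f≗f′ (a ∷ z)) g≗g′ w)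

+-interchange : ∀ p q r s → (p + q) + (r + s) ≡ (p + r) + (q + s)
+-interchange = solve 4 (λ p q r s → (p :+ q) :+ (r :+ s) := (p :+ r) :+ (q :+ s)) refl

⋆-distribʳ : ∀ f f′ g w → ((λ z → f z + f′ z) ⋆ g) w ≡ (f ⋆ g) w + (f′ ⋆ g) w
⋆-distribʳ f f′ g []      = *-distribʳ-+ (g []) (f []) (f′ [])
⋆-distribʳ f f′ g (a ∷ w) =
  trans (cong₂ _+_ (*-distribʳ-+ (g (a ∷ w)) (f []) (f′ [])) (⋆-distribʳ (λ z → f (a ∷ z)) (λ z → f′ (a ∷ z)) g w))
        (+-interchange (f [] * g (a ∷ w)) _ (((λ z → f (a ∷ z)) ⋆ g) w) _)

⋆-distribˡ : ∀ f g g′ w → (f ⋆ (λ z → g z + g′ z)) w ≡ (f ⋆ g) w + (f ⋆ g′) w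
⋆-distribˡ f g g′ []      = *-distribˡ-+ (f []) (g []) (g′ [])
⋆-distribˡ f g g′ (a ∷ w) =
  trans (cong₂ _+_ (*-distribˡ-+ (f []) (g (a ∷ w)) (g′ (a ∷ w))) (⋆-distribˡ (λ z → f (a ∷ z)) g g′ w))
        (+-interchange (f [] * g (a ∷ w)) _ (((λ z → f (a ∷ z)) ⋆ g) w) _)

⋆-scaleˡ : ∀ c f g w → ((λ z → c * f z) ⋆ g) w ≡ c * (f ⋆ g) w
⋆-scaleˡ c f g []      = *-assoc c (f []) (g [])
⋆-scaleˡ c f g (a ∷ w) =
  trans (cong₂ _+_ (*-assoc c (f []) (g (a ∷ w))) (⋆-scaleˡ c _ g w)) (sym (*-distribˡ-+ c _ _))

*-middle : ∀ a b c → a * (c * b) ≡ c * (a * b)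
*-middle = solve 3 (λ a b c → a :* (c :* b) := c :* (a :* b)) refl

⋆-scaleʳ : ∀ c f g w → (f ⋆ (λ z → c * g z)) w ≡ c * (f ⋆ g) w
⋆-scaleʳ c f g []      = *-middle (f []) (g []) c
⋆-scaleʳ c f g (a ∷ w) =
  trans (cong₂ _+_ (*-middle (f []) (g (a ∷ w)) c) (⋆-scaleʳ c _ g w)) (sym (*-distribˡ-+ c _ _))

⋆-zeroˡ : ∀ f g → (∀ z → f z ≡ 0ℚ) → ∀ w → (f ⋆ g) w ≡ 0ℚ
⋆-zeroˡ f g f≗0 []      = trans (cong (_* g []) (f≗0 [])) (*-zeroˡ (g []))
⋆-zeroˡ f g f≗0 (a ∷ w) =
  trans (cong₂ _+_ (trans (cong (_* g (a ∷ w)) (f≗0 [])) (*-zeroˡ (g (a ∷ w))))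
                   (⋆-zeroˡ _ g (λ z → f≗0 (a ∷ z)) w))
        (+-identityˡ 0ℚ)

⋆-zeroʳ : ∀ f g → (∀ z → g z ≡ 0ℚ) → ∀ w → (f ⋆ g) w ≡ 0ℚ
⋆-zeroʳ f g g≗0 []      = trans (cong (f [] *_) (g≗0 [])) (*-zeroʳ (f []))
⋆-zeroʳ f g g≗0 (a ∷ w) =
  trans (cong₂ _+_ (trans (cong (f [] *_) (g≗0 (a ∷ w))) (*-zeroʳ (f []))) (⋆-zeroʳ _ g g≗0 w))
        (+-identityˡ 0ℚ)

⋆-assoc : ∀ f g h w → ((f ⋆ g) ⋆ h) w ≡ (f ⋆ (g ⋆ h)) w
⋆-assoc f g h []      = *-assoc (f []) (g []) (h [])
⋆-assoc f g h (a ∷ w) = begin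
    (f [] * g []) * h (a ∷ w) + ((λ z → f [] * g (a ∷ z) + ((λ z′ → f (a ∷ z′)) ⋆ g) z) ⋆ h) w
  ≡⟨ cong ((f [] * g []) * h (a ∷ w) +_) (⋆-distribʳ _ _ h w) ⟩
    (f [] * g []) * h (a ∷ w) + (((λ z → f [] * g (a ∷ z)) ⋆ h) w + (((λ z → f (a ∷ z)) ⋆ g) ⋆ h) w)
  ≡⟨ cong₂ (λ s t → (f [] * g []) * h (a ∷ w) + (s + t)) (⋆-scaleˡ (f []) _ h w) (⋆-assoc _ g h w) ⟩
    (f [] * g []) * h (a ∷ w) + (f [] * ((λ z → g (a ∷ z)) ⋆ h) w + ((λ z → f (a ∷ z)) ⋆ (g ⋆ h)) w)
  ≡⟨ solve 5 (λ F G H C D → (F :* G) :* H :+ (F :* C :+ D) := F :* (G :* H :+ C) :+ D) refl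
       (f []) (g []) (h (a ∷ w)) (((λ z → g (a ∷ z)) ⋆ h) w) (((λ z → f (a ∷ z)) ⋆ (g ⋆ h)) w) ⟩
    f [] * (g [] * h (a ∷ w) + ((λ z → g (a ∷ z)) ⋆ h) w) + ((λ z → f (a ∷ z)) ⋆ (g ⋆ h)) w
  ∎
  where open ≡-Reasoning

⋆-identityˡ : ∀ c g w → (termCoeff [] c ⋆ g) w ≡ c * g w
⋆-identityˡ c g []      = refl
⋆-identityˡ c g (a ∷ w) =
  trans (cong (c * g (a ∷ w) +_) (⋆-zeroˡ _ g (λ _ → refl) w)) (+-identityʳ _)

⋆-identityʳ : ∀ f c w → (f ⋆ termCoeff [] c) w ≡ f w * c
⋆-identityʳ f c []      = refl
⋆-identityʳ f c (a ∷ w) =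
  trans (cong₂ _+_ (*-zeroʳ (f [])) (⋆-identityʳ (λ z → f (a ∷ z)) c w)) (+-identityˡ _)

termCoeff-⋆ : ∀ u v c d w → (termCoeff u c ⋆ termCoeff v d) w ≡ termCoeff (u ++ v) (c * d) w
termCoeff-⋆ []      v c d w       = trans (⋆-identityˡ c (termCoeff v d) w) (sym (termCoeff-* v c d w))
termCoeff-⋆ (a ∷ u) v c d []      = *-zeroˡ (termCoeff v d [])
termCoeff-⋆ (a ∷ u) v c d (b ∷ w) =
  trans (cong (_+ ((λ z → termCoeff (a ∷ u) c (b ∷ z)) ⋆ termCoeff v d) w) (*-zeroˡ (termCoeff v d (b ∷ w))))
        (trans (+-identityˡ _) (tail a b))
  where
  sameLetter : ∀ a → ((λ z → termCoeff (a ∷ u) c (a ∷ z)) ⋆ termCoeff v d) w ≡ termCoeff (a ∷ u ++ v) (c * d) (a ∷ w)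
  sameLetter a = trans (⋆-cong (termCoeff-∷ a u c) (λ _ → refl) w)
                       (trans (termCoeff-⋆ u v c d w) (sym (termCoeff-∷ a (u ++ v) (c * d) w)))
  otherLetter : ∀ {a b} → ¬ a ≡ b →
    ((λ z → termCoeff (a ∷ u) c (b ∷ z)) ⋆ termCoeff v d) w ≡ termCoeff (a ∷ u ++ v) (c * d) (b ∷ w)
  otherLetter a≢b = trans (⋆-zeroˡ _ _ (termCoeff-∷-≢ a≢b u c) w) (sym (termCoeff-∷-≢ a≢b (u ++ v) (c * d) w))
  tail : ∀ a b → ((λ z → termCoeff (a ∷ u) c (b ∷ z)) ⋆ termCoeff v d) w ≡ termCoeff (a ∷ u ++ v) (c * d) (b ∷ w)
  tail X X = sameLetter X
  tail X Y = otherLetter {X} {Y} (λ ())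
  tail Y X = otherLetter {Y} {X} (λ ())
  tail Y Y = sameLetter Y

coeff-row : ∀ c u q w →
  coeff (map (λ { (d , v) → (c * d , u ++ v) }) q) w ≡ (termCoeff u c ⋆ coeff q) w
coeff-row c u []            w = sym (⋆-zeroʳ _ _ (λ _ → refl) w)
coeff-row c u ((d , v) ∷ q) w =
  trans (cong₂ _+_ (sym (termCoeff-⋆ u v c d w)) (coeff-row c u q w))
        (sym (⋆-distribˡ (termCoeff u c) (termCoeff v d) (coeff q) w))

coeff-⊗ : ∀ p q w → coeff (p ⊗ q) w ≡ (coeff p ⋆ coeff q) w
coeff-⊗ []            q w = sym (⋆-zeroˡ _ _ (λ _ → refl) w)
coeff-⊗ ((c , u) ∷ p) q w =
  trans (coeff-++ (map (λ { (d , v) → (c * d , u ++ v) }) q) (p ⊗ q) w)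
        (trans (cong₂ _+_ (coeff-row c u q w) (coeff-⊗ p q w))
               (sym (⋆-distribʳ (termCoeff u c) (coeff p) (coeff q) w)))

-- A record around _≈_, so that both sides can be inferred from a proof.
infix 4 _≋_
record _≋_ (p q : H) : Set where
  constructor coeffwise
  field coeff-≡ : p ≈ q
open _≋_

≋-refl : ∀ {p} → p ≋ p
≋-refl = coeffwise λ _ → refl

≋-sym : ∀ {p q} → p ≋ q → q ≋ p
≋-sym p≋q = coeffwise λ w → sym (coeff-≡ p≋q w)

≋-trans : ∀ {p q r} → p ≋ q → q ≋ r → p ≋ r
≋-trans p≋q q≋r = coeffwise λ w → trans (coeff-≡ p≋q w) (coeff-≡ q≋r w)

≡⇒≋ : ∀ {p q} → p ≡ q → p ≋ q
≡⇒≋ refl = ≋-refl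

H-setoid : Setoid _ _
H-setoid = record
  { Carrier = H ; _≈_ = _≋_
  ; isEquivalence = record { refl = ≋-refl ; sym = ≋-sym ; trans = ≋-trans } }

module ≋-Reasoning = Relation.Binary.Reasoning.Setoid H-setoid

⊕-cong : ∀ {p p′ q q′} → p ≋ p′ → q ≋ q′ → p ⊕ q ≋ p′ ⊕ q′
⊕-cong {p} {p′} {q} {q′} p≋p′ q≋q′ = coeffwise λ w →
  trans (coeff-++ p q w) (trans (cong₂ _+_ (coeff-≡ p≋p′ w) (coeff-≡ q≋q′ w)) (sym (coeff-++ p′ q′ w)))

·-cong : ∀ c {p p′} → p ≋ p′ → c · p ≋ c · p′
·-cong c {p} {p′} p≋p′ = coeffwise λ w →
  trans (coeff-· c p w) (trans (cong (c *_) (coeff-≡ p≋p′ w)) (sym (coeff-· c p′ w)))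

⊗-cong : ∀ {p p′ q q′} → p ≋ p′ → q ≋ q′ → p ⊗ q ≋ p′ ⊗ q′
⊗-cong {p} {p′} {q} {q′} p≋p′ q≋q′ = coeffwise λ w →
  trans (coeff-⊗ p q w) (trans (⋆-cong (coeff-≡ p≋p′) (coeff-≡ q≋q′) w) (sym (coeff-⊗ p′ q′ w)))

⊕-assoc : ∀ p q r → (p ⊕ q) ⊕ r ≋ p ⊕ (q ⊕ r)
⊕-assoc p q r = ≡⇒≋ (List.++-assoc p q r)

⊕-identityʳ : ∀ p → p ⊕ zeroH ≋ p
⊕-identityʳ p = ≡⇒≋ (List.++-identityʳ p)

·-distribʳ : ∀ c d p → (c + d) · p ≋ c · p ⊕ d · p
·-distribʳ c d p = coeffwise λ w →
  trans (coeff-· (c + d) p w)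
        (trans (*-distribʳ-+ (coeff p w) c d)
               (sym (trans (coeff-++ (c · p) (d · p) w) (cong₂ _+_ (coeff-· c p w) (coeff-· d p w)))))

·-distribˡ : ∀ c p q → c · (p ⊕ q) ≋ c · p ⊕ c · q
·-distribˡ c p q = ≡⇒≋ (List.map-++ _ p q)

·-assoc : ∀ c d p → c · (d · p) ≋ (c * d) · p
·-assoc c d p = coeffwise λ w →
  trans (coeff-· c (d · p) w)
        (trans (cong (c *_) (coeff-· d p w)) (trans (sym (*-assoc c d (coeff p w))) (sym (coeff-· (c * d) p w))))

·-zeroˡ : ∀ p → 0ℚ · p ≋ zeroH
·-zeroˡ p = coeffwise λ w → trans (coeff-· 0ℚ p w) (*-zeroˡ (coeff p w))

·-identityˡ : ∀ p → 1ℚ · p ≋ p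
·-identityˡ p = coeffwise λ w → trans (coeff-· 1ℚ p w) (*-identityˡ (coeff p w))

·-comm : ∀ c d p → c · (d · p) ≋ d · (c · p)
·-comm c d p =
  ≋-trans (·-assoc c d p) (≋-trans (≡⇒≋ (cong (_· p) (*-comm c d))) (≋-sym (·-assoc d c p)))

⊗-assoc : ∀ p q r → (p ⊗ q) ⊗ r ≋ p ⊗ (q ⊗ r)
⊗-assoc p q r = coeffwise λ w → begin
    coeff ((p ⊗ q) ⊗ r) w                 ≡⟨ coeff-⊗ (p ⊗ q) r w ⟩
    (coeff (p ⊗ q) ⋆ coeff r) w           ≡⟨ ⋆-cong (coeff-⊗ p q) (λ _ → refl) w ⟩
    ((coeff p ⋆ coeff q) ⋆ coeff r) w     ≡⟨ ⋆-assoc (coeff p) (coeff q) (coeff r) w ⟩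
    (coeff p ⋆ (coeff q ⋆ coeff r)) w     ≡⟨ ⋆-cong (λ _ → refl) (λ z → sym (coeff-⊗ q r z)) w ⟩
    (coeff p ⋆ coeff (q ⊗ r)) w           ≡⟨ sym (coeff-⊗ p (q ⊗ r) w) ⟩
    coeff (p ⊗ (q ⊗ r)) w                 ∎
  where open ≡-Reasoning

⊗-distribˡ : ∀ p q r → p ⊗ (q ⊕ r) ≋ p ⊗ q ⊕ p ⊗ r
⊗-distribˡ p q r = coeffwise λ w → begin
    coeff (p ⊗ (q ⊕ r)) w                            ≡⟨ coeff-⊗ p (q ⊕ r) w ⟩
    (coeff p ⋆ coeff (q ⊕ r)) w                      ≡⟨ ⋆-cong (λ _ → refl) (coeff-++ q r) w ⟩
    (coeff p ⋆ (λ z → coeff q z + coeff r z)) w      ≡⟨ ⋆-distribˡ (coeff p) (coeff q) (coeff r) w ⟩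
    (coeff p ⋆ coeff q) w + (coeff p ⋆ coeff r) w    ≡⟨ sym (cong₂ _+_ (coeff-⊗ p q w) (coeff-⊗ p r w)) ⟩
    coeff (p ⊗ q) w + coeff (p ⊗ r) w                ≡⟨ sym (coeff-++ (p ⊗ q) (p ⊗ r) w) ⟩
    coeff (p ⊗ q ⊕ p ⊗ r) w                          ∎
  where open ≡-Reasoning

⊗-distribʳ : ∀ p q r → (q ⊕ r) ⊗ p ≋ q ⊗ p ⊕ r ⊗ p
⊗-distribʳ p q r = ≡⇒≋ (List.concatMap-++ _ q r)

⊗-·ˡ : ∀ c p q → (c · p) ⊗ q ≋ c · (p ⊗ q)
⊗-·ˡ c p q = coeffwise λ w → begin
    coeff ((c · p) ⊗ q) w                    ≡⟨ coeff-⊗ (c · p) q w ⟩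
    (coeff (c · p) ⋆ coeff q) w              ≡⟨ ⋆-cong (coeff-· c p) (λ _ → refl) w ⟩
    ((λ z → c * coeff p z) ⋆ coeff q) w      ≡⟨ ⋆-scaleˡ c (coeff p) (coeff q) w ⟩
    c * (coeff p ⋆ coeff q) w                ≡⟨ cong (c *_) (sym (coeff-⊗ p q w)) ⟩
    c * coeff (p ⊗ q) w                      ≡⟨ sym (coeff-· c (p ⊗ q) w) ⟩
    coeff (c · (p ⊗ q)) w                    ∎
  where open ≡-Reasoning

⊗-·ʳ : ∀ c p q → p ⊗ (c · q) ≋ c · (p ⊗ q)
⊗-·ʳ c p q = coeffwise λ w → begin
    coeff (p ⊗ (c · q)) w                    ≡⟨ coeff-⊗ p (c · q) w ⟩
    (coeff p ⋆ coeff (c · q)) w              ≡⟨ ⋆-cong (λ _ → refl) (coeff-· c q) w ⟩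
    (coeff p ⋆ (λ z → c * coeff q z)) w      ≡⟨ ⋆-scaleʳ c (coeff p) (coeff q) w ⟩
    c * (coeff p ⋆ coeff q) w                ≡⟨ cong (c *_) (sym (coeff-⊗ p q w)) ⟩
    c * coeff (p ⊗ q) w                      ≡⟨ sym (coeff-· c (p ⊗ q) w) ⟩
    coeff (c · (p ⊗ q)) w                    ∎
  where open ≡-Reasoning

⊗-zeroʳ : ∀ p → p ⊗ zeroH ≋ zeroH
⊗-zeroʳ p = coeffwise λ w → trans (coeff-⊗ p zeroH w) (⋆-zeroʳ (coeff p) _ (λ _ → refl) w)

coeff-oneH : ∀ w → coeff oneH w ≡ termCoeff [] 1ℚ w
coeff-oneH w = +-identityʳ _

⊗-identityˡ : ∀ p → oneH ⊗ p ≋ p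
⊗-identityˡ p = coeffwise λ w →
  trans (coeff-⊗ oneH p w)
        (trans (⋆-cong coeff-oneH (λ _ → refl) w) (trans (⋆-identityˡ 1ℚ (coeff p) w) (*-identityˡ _)))

⊗-identityʳ : ∀ p → p ⊗ oneH ≋ p
⊗-identityʳ p = coeffwise λ w →
  trans (coeff-⊗ p oneH w)
        (trans (⋆-cong (λ _ → refl) coeff-oneH w) (trans (⋆-identityʳ (coeff p) 1ℚ w) (*-identityʳ _)))

-- Deciding identities of non-commutative polynomial expressions

Monomial : Set
Monomial = List ℕ

-- Sorted by the lexicographic order on monomials, without zero coefficients,
-- so that equal polynomials have identical normal forms.
NormalForm : Set
NormalForm = List (ℚ × Monomial)

data Ordering (m m′ : Monomial) : Set where
  less greater : Ordering m m′
  equal : m ≡ m′ → Ordering m m′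

compareMonomial : (m m′ : Monomial) → Ordering m m′
compareMonomial []      []        = equal refl
compareMonomial []      (_ ∷ _)   = less
compareMonomial (_ ∷ _) []        = greater
compareMonomial (a ∷ m) (b ∷ m′) with ℕ.<-cmp a b
... | tri< _ _ _ = less
... | tri> _ _ _ = greater
... | tri≈ _ refl _ with compareMonomial m m′
...   | less       = less
...   | greater    = greater
...   | equal refl = equal refl

⟦_⟧ₘ : Monomial → (ℕ → H) → H
⟦ []    ⟧ₘ ρ = oneH
⟦ i ∷ m ⟧ₘ ρ = ρ i ⊗ ⟦ m ⟧ₘ ρ

⟦_⟧ₙ : NormalForm → (ℕ → H) → H
⟦ []          ⟧ₙ ρ = zeroH
⟦ (c , m) ∷ L ⟧ₙ ρ = c · ⟦ m ⟧ₘ ρ ⊕ ⟦ L ⟧ₙ ρ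

insertNonzero : ℚ → Monomial → NormalForm → NormalForm
insertNonzero c m []              = (c , m) ∷ []
insertNonzero c m ((d , m′) ∷ L) with compareMonomial m m′
... | less    = (c , m) ∷ (d , m′) ∷ L
... | greater = (d , m′) ∷ insertNonzero c m L
... | equal _ with (c + d) ≟ 0ℚ
...   | yes _ = L
...   | no _  = (c + d , m′) ∷ L

insert : ℚ → Monomial → NormalForm → NormalForm
insert c m L with c ≟ 0ℚ
... | yes _ = L
... | no _  = insertNonzero c m L

⊕-left-comm : ∀ p q r → p ⊕ (q ⊕ r) ≋ q ⊕ (p ⊕ r)
⊕-left-comm p q r = coeffwise λ w → begin
    coeff (p ⊕ (q ⊕ r)) w                 ≡⟨ coeff-++ p (q ⊕ r) w ⟩
    coeff p w + coeff (q ⊕ r) w           ≡⟨ cong (coeff p w +_) (coeff-++ q r w) ⟩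
    coeff p w + (coeff q w + coeff r w)   ≡⟨ solve 3 (λ a b d → a :+ (b :+ d) := b :+ (a :+ d)) refl
                                                     (coeff p w) (coeff q w) (coeff r w) ⟩
    coeff q w + (coeff p w + coeff r w)   ≡⟨ cong (coeff q w +_) (sym (coeff-++ p r w)) ⟩
    coeff q w + coeff (p ⊕ r) w           ≡⟨ sym (coeff-++ q (p ⊕ r) w) ⟩
    coeff (q ⊕ (p ⊕ r)) w                 ∎
  where open ≡-Reasoning

opposite-terms-cancel : ∀ c d p r → c + d ≡ 0ℚ → r ≋ c · p ⊕ (d · p ⊕ r)
opposite-terms-cancel c d p r c+d≡0 = coeffwise λ w → sym (begin
    coeff (c · p ⊕ (d · p ⊕ r)) w                 ≡⟨ coeff-++ (c · p) (d · p ⊕ r) w ⟩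
    coeff (c · p) w + coeff (d · p ⊕ r) w         ≡⟨ cong₂ _+_ (coeff-· c p w) (coeff-++ (d · p) r w) ⟩
    c * coeff p w + (coeff (d · p) w + coeff r w) ≡⟨ cong (λ t → c * coeff p w + (t + coeff r w)) (coeff-· d p w) ⟩
    c * coeff p w + (d * coeff p w + coeff r w)   ≡⟨ solve 4 (λ a b k l → a :* k :+ (b :* k :+ l) := (a :+ b) :* k :+ l)
                                                             refl c d (coeff p w) (coeff r w) ⟩
    (c + d) * coeff p w + coeff r w               ≡⟨ cong (λ t → t * coeff p w + coeff r w) c+d≡0 ⟩
    0ℚ * coeff p w + coeff r w                    ≡⟨ cong (_+ coeff r w) (*-zeroˡ (coeff p w)) ⟩
    0ℚ + coeff r w                                ≡⟨ +-identityˡ _ ⟩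
    coeff r w                                     ∎)
  where open ≡-Reasoning

insertNonzero-sound : ∀ ρ c m L → ⟦ insertNonzero c m L ⟧ₙ ρ ≋ c · ⟦ m ⟧ₘ ρ ⊕ ⟦ L ⟧ₙ ρ
insertNonzero-sound ρ c m []              = ≋-refl
insertNonzero-sound ρ c m ((d , m′) ∷ L) with compareMonomial m m′
... | less    = ≋-refl
... | greater = ≋-trans (⊕-cong ≋-refl (insertNonzero-sound ρ c m L)) (⊕-left-comm (d · ⟦ m′ ⟧ₘ ρ) (c · ⟦ m ⟧ₘ ρ) (⟦ L ⟧ₙ ρ))
... | equal refl with (c + d) ≟ 0ℚ
...   | yes c+d≡0 = opposite-terms-cancel c d (⟦ m ⟧ₘ ρ) (⟦ L ⟧ₙ ρ) c+d≡0
...   | no _      = ≋-trans (⊕-cong (·-distribʳ c d (⟦ m ⟧ₘ ρ)) ≋-refl) (⊕-assoc (c · ⟦ m ⟧ₘ ρ) (d · ⟦ m ⟧ₘ ρ) (⟦ L ⟧ₙ ρ))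

insert-sound : ∀ ρ c m L → ⟦ insert c m L ⟧ₙ ρ ≋ c · ⟦ m ⟧ₘ ρ ⊕ ⟦ L ⟧ₙ ρ
insert-sound ρ c m L with c ≟ 0ℚ
... | yes refl = ≋-sym (⊕-cong (·-zeroˡ (⟦ m ⟧ₘ ρ)) ≋-refl)
... | no _     = insertNonzero-sound ρ c m L

_+ₙ_ : NormalForm → NormalForm → NormalForm
[]            +ₙ L = L
((c , m) ∷ K) +ₙ L = insert c m (K +ₙ L)

+ₙ-sound : ∀ ρ K L → ⟦ K +ₙ L ⟧ₙ ρ ≋ ⟦ K ⟧ₙ ρ ⊕ ⟦ L ⟧ₙ ρ
+ₙ-sound ρ []            L = ≋-refl
+ₙ-sound ρ ((c , m) ∷ K) L =
  ≋-trans (insert-sound ρ c m (K +ₙ L))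
          (≋-trans (⊕-cong ≋-refl (+ₙ-sound ρ K L)) (≋-sym (⊕-assoc (c · ⟦ m ⟧ₘ ρ) _ _)))

_·ₙ_ : ℚ → NormalForm → NormalForm
c ·ₙ []            = []
c ·ₙ ((d , m) ∷ L) = insert (c * d) m (c ·ₙ L)

·ₙ-sound : ∀ ρ c L → ⟦ c ·ₙ L ⟧ₙ ρ ≋ c · ⟦ L ⟧ₙ ρ
·ₙ-sound ρ c []            = ≋-refl
·ₙ-sound ρ c ((d , m) ∷ L) =
  ≋-trans (insert-sound ρ (c * d) m (c ·ₙ L))
          (≋-trans (⊕-cong (≋-sym (·-assoc c d (⟦ m ⟧ₘ ρ))) (·ₙ-sound ρ c L))
                   (≋-sym (·-distribˡ c (d · ⟦ m ⟧ₘ ρ) (⟦ L ⟧ₙ ρ))))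

⟦++⟧ₘ : ∀ ρ m m′ → ⟦ m ++ m′ ⟧ₘ ρ ≋ ⟦ m ⟧ₘ ρ ⊗ ⟦ m′ ⟧ₘ ρ
⟦++⟧ₘ ρ []      m′ = ≋-sym (⊗-identityˡ (⟦ m′ ⟧ₘ ρ))
⟦++⟧ₘ ρ (i ∷ m) m′ = ≋-trans (⊗-cong (≋-refl {ρ i}) (⟦++⟧ₘ ρ m m′)) (≋-sym (⊗-assoc (ρ i) (⟦ m ⟧ₘ ρ) (⟦ m′ ⟧ₘ ρ)))

·⊗· : ∀ c d p q → (c · p) ⊗ (d · q) ≋ (c * d) · (p ⊗ q)
·⊗· c d p q = ≋-trans (⊗-·ˡ c p (d · q)) (≋-trans (·-cong c (⊗-·ʳ d p q)) (·-assoc c d (p ⊗ q)))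

termTimes : ℚ → Monomial → NormalForm → NormalForm
termTimes c m []              = []
termTimes c m ((d , m′) ∷ L) = insert (c * d) (m ++ m′) (termTimes c m L)

termTimes-sound : ∀ ρ c m L → ⟦ termTimes c m L ⟧ₙ ρ ≋ (c · ⟦ m ⟧ₘ ρ) ⊗ ⟦ L ⟧ₙ ρ
termTimes-sound ρ c m []              = ≋-sym (⊗-zeroʳ (c · ⟦ m ⟧ₘ ρ))
termTimes-sound ρ c m ((d , m′) ∷ L) =
  ≋-trans (insert-sound ρ (c * d) (m ++ m′) (termTimes c m L))
  (≋-trans (⊕-cong (≋-trans (·-cong (c * d) (⟦++⟧ₘ ρ m m′)) (≋-sym (·⊗· c d (⟦ m ⟧ₘ ρ) (⟦ m′ ⟧ₘ ρ)))) (termTimes-sound ρ c m L))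
           (≋-sym (⊗-distribˡ (c · ⟦ m ⟧ₘ ρ) (d · ⟦ m′ ⟧ₘ ρ) (⟦ L ⟧ₙ ρ))))

_*ₙ_ : NormalForm → NormalForm → NormalForm
[]            *ₙ L = []
((c , m) ∷ K) *ₙ L = termTimes c m L +ₙ (K *ₙ L)

*ₙ-sound : ∀ ρ K L → ⟦ K *ₙ L ⟧ₙ ρ ≋ ⟦ K ⟧ₙ ρ ⊗ ⟦ L ⟧ₙ ρ
*ₙ-sound ρ []            L = ≋-refl
*ₙ-sound ρ ((c , m) ∷ K) L =
  ≋-trans (+ₙ-sound ρ (termTimes c m L) (K *ₙ L))
  (≋-trans (⊕-cong (termTimes-sound ρ c m L) (*ₙ-sound ρ K L))
           (≋-sym (⊗-distribʳ (⟦ L ⟧ₙ ρ) (c · ⟦ m ⟧ₘ ρ) (⟦ K ⟧ₙ ρ))))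

infixl 6 _:⊕_ _:⊖_
infixl 7 _:⊗_
infixr 8 _:·_

data Expr : Set where
  V               : ℕ → Expr
  _:·_            : ℚ → Expr → Expr
  _:⊕_ _:⊖_ _:⊗_  : Expr → Expr → Expr
  :0 :1           : Expr

⟪_⟫ : Expr → (ℕ → H) → H
⟪ V i    ⟫ ρ = ρ i
⟪ c :· e ⟫ ρ = c · ⟪ e ⟫ ρ
⟪ e :⊕ f ⟫ ρ = ⟪ e ⟫ ρ ⊕ ⟪ f ⟫ ρ
⟪ e :⊖ f ⟫ ρ = ⟪ e ⟫ ρ ⊖ ⟪ f ⟫ ρ
⟪ e :⊗ f ⟫ ρ = ⟪ e ⟫ ρ ⊗ ⟪ f ⟫ ρ
⟪ :0     ⟫ ρ = zeroH
⟪ :1     ⟫ ρ = oneH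

normalise : Expr → NormalForm
normalise (V i)    = insert 1ℚ (i ∷ []) []
normalise (c :· e) = c ·ₙ normalise e
normalise (e :⊕ f) = normalise e +ₙ normalise f
normalise (e :⊖ f) = normalise e +ₙ ((- 1ℚ) ·ₙ normalise f)
normalise (e :⊗ f) = normalise e *ₙ normalise f
normalise :0       = []
normalise :1       = insert 1ℚ [] []

normalise-sound : ∀ ρ e → ⟦ normalise e ⟧ₙ ρ ≋ ⟪ e ⟫ ρ
normalise-sound ρ (V i)    =
  ≋-trans (insert-sound ρ 1ℚ (i ∷ []) [])
          (≋-trans (⊕-identityʳ (1ℚ · (ρ i ⊗ oneH))) (≋-trans (·-identityˡ (ρ i ⊗ oneH)) (⊗-identityʳ (ρ i))))
normalise-sound ρ (c :· e) = ≋-trans (·ₙ-sound ρ c (normalise e)) (·-cong c (normalise-sound ρ e))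
normalise-sound ρ (e :⊕ f) =
  ≋-trans (+ₙ-sound ρ (normalise e) (normalise f)) (⊕-cong (normalise-sound ρ e) (normalise-sound ρ f))
normalise-sound ρ (e :⊖ f) =
  ≋-trans (+ₙ-sound ρ (normalise e) ((- 1ℚ) ·ₙ normalise f))
          (⊕-cong (normalise-sound ρ e)
                  (≋-trans (·ₙ-sound ρ (- 1ℚ) (normalise f)) (·-cong (- 1ℚ) (normalise-sound ρ f))))
normalise-sound ρ (e :⊗ f) =
  ≋-trans (*ₙ-sound ρ (normalise e) (normalise f)) (⊗-cong (normalise-sound ρ e) (normalise-sound ρ f))
normalise-sound ρ :0       = ≋-refl
normalise-sound ρ :1       =
  ≋-trans (insert-sound ρ 1ℚ [] []) (≋-trans (⊕-identityʳ (1ℚ · oneH)) (·-identityˡ oneH))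

env : List H → ℕ → H
env []       i       = zeroH
env (p ∷ ps) zero    = p
env (p ∷ ps) (suc i) = env ps i

prove : ∀ ps e f → normalise e ≡ normalise f → ⟪ e ⟫ (env ps) ≋ ⟪ f ⟫ (env ps)
prove ps e f nf≡ =
  ≋-trans (≋-sym (normalise-sound (env ps) e))
          (≋-trans (≡⇒≋ (cong (λ L → ⟦ L ⟧ₙ (env ps)) nf≡)) (normalise-sound (env ps) f))

⊕-interchange : ∀ p q r s → (p ⊕ q) ⊕ (r ⊕ s) ≋ (p ⊕ r) ⊕ (q ⊕ s)
⊕-interchange p q r s = prove (p ∷ q ∷ r ∷ s ∷ []) ((V 0 :⊕ V 1) :⊕ (V 2 :⊕ V 3)) ((V 0 :⊕ V 2) :⊕ (V 1 :⊕ V 3)) refl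

linearExt : H → (Word → ℚ) → ℚ
linearExt []            g = 0ℚ
linearExt ((c , u) ∷ p) g = c * g u + linearExt p g

linearExt-cong : ∀ p {g g′} → (∀ u → g u ≡ g′ u) → linearExt p g ≡ linearExt p g′
linearExt-cong []            g≗g′ = refl
linearExt-cong ((c , u) ∷ p) g≗g′ = cong₂ _+_ (cong (c *_) (g≗g′ u)) (linearExt-cong p g≗g′)

linearExt-+ : ∀ p g g′ → linearExt p (λ u → g u + g′ u) ≡ linearExt p g + linearExt p g′
linearExt-+ []            g g′ = sym (+-identityˡ 0ℚ)
linearExt-+ ((c , u) ∷ p) g g′ =
  trans (cong₂ _+_ (*-distribˡ-+ c (g u) (g′ u)) (linearExt-+ p g g′))
        (+-interchange (c * g u) (c * g′ u) (linearExt p g) (linearExt p g′))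

linearExt-++ : ∀ p q g → linearExt (p ++ q) g ≡ linearExt p g + linearExt q g
linearExt-++ []            q g = sym (+-identityˡ _)
linearExt-++ ((c , u) ∷ p) q g =
  trans (cong (c * g u +_) (linearExt-++ p q g)) (sym (+-assoc (c * g u) _ _))

linearExt-· : ∀ c p g → linearExt (c · p) g ≡ c * linearExt p g
linearExt-· c []            g = sym (*-zeroʳ c)
linearExt-· c ((d , u) ∷ p) g =
  trans (cong₂ _+_ (*-assoc c d (g u)) (linearExt-· c p g)) (sym (*-distribˡ-+ c _ _))

linearExt-row : ∀ c u q g →
  linearExt (map (λ { (d , v) → (c * d , u ++ v) }) q) g ≡ c * linearExt q (λ v → g (u ++ v))
linearExt-row c u []            g = sym (*-zeroʳ c)
linearExt-row c u ((d , v) ∷ q) g =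
  trans (cong₂ _+_ (*-assoc c d (g (u ++ v))) (linearExt-row c u q g)) (sym (*-distribˡ-+ c _ _))

linearExt-⊗ : ∀ p q g → linearExt (p ⊗ q) g ≡ linearExt p (λ u → linearExt q (λ v → g (u ++ v)))
linearExt-⊗ []            q g = refl
linearExt-⊗ ((c , u) ∷ p) q g =
  trans (linearExt-++ (map (λ { (d , v) → (c * d , u ++ v) }) q) (p ⊗ q) g)
        (cong₂ _+_ (linearExt-row c u q g) (linearExt-⊗ p q g))

⋆-linearExtˡ : ∀ p (F : Word → Word → ℚ) g z →
  ((λ w → linearExt p (λ u → F u w)) ⋆ g) z ≡ linearExt p (λ u → (F u ⋆ g) z)
⋆-linearExtˡ []            F g z = ⋆-zeroˡ _ g (λ _ → refl) z
⋆-linearExtˡ ((c , u) ∷ p) F g z =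
  trans (⋆-distribʳ (λ w → c * F u w) (λ w → linearExt p (λ u → F u w)) g z)
        (cong₂ _+_ (⋆-scaleˡ c (F u) g z) (⋆-linearExtˡ p F g z))

⋆-linearExtʳ : ∀ q f (G : Word → Word → ℚ) z →
  (f ⋆ (λ w → linearExt q (λ v → G v w))) z ≡ linearExt q (λ v → (f ⋆ G v) z)
⋆-linearExtʳ []            f G z = ⋆-zeroʳ f _ (λ _ → refl) z
⋆-linearExtʳ ((c , v) ∷ q) f G z =
  trans (⋆-distribˡ f (λ w → c * G v w) (λ w → linearExt q (λ v → G v w)) z)
        (cong₂ _+_ (⋆-scaleʳ c f (G v) z) (⋆-linearExtʳ q f G z))

linearExt-⋆ : ∀ p q (F G : Word → Word → ℚ) z →
  linearExt p (λ u → linearExt q (λ v → (F u ⋆ G v) z))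
    ≡ ((λ w → linearExt p (λ u → F u w)) ⋆ (λ w → linearExt q (λ v → G v w))) z
linearExt-⋆ p q F G z = sym (trans
  (⋆-linearExtˡ p F (λ w → linearExt q (λ v → G v w)) z)
  (linearExt-cong p (λ u → ⋆-linearExtʳ q (F u) G z)))

coeff-as-linearExt : ∀ q w → coeff q w ≡ linearExt q (λ v → coeff (wordH v) w)
coeff-as-linearExt []            w = refl
coeff-as-linearExt ((c , v) ∷ q) w =
  cong₂ _+_ (sym (trans (cong (c *_) (+-identityʳ _)) (one v))) (coeff-as-linearExt q w)
  where
  one : ∀ v → c * termCoeff v 1ℚ w ≡ termCoeff v c w
  one v with v ≟W w
  ... | yes _ = *-identityʳ c
  ... | no _  = *-zeroʳ c

sumLength≤ : ℕ → (Word → ℚ) → ℚ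
sumLength≤ zero    h = h []
sumLength≤ (suc n) h = h [] + (sumLength≤ n (λ u → h (X ∷ u)) + sumLength≤ n (λ u → h (Y ∷ u)))

sumLength≤-cong : ∀ n {h h′} → (∀ u → h u ≡ h′ u) → sumLength≤ n h ≡ sumLength≤ n h′
sumLength≤-cong zero    h≗h′ = h≗h′ []
sumLength≤-cong (suc n) h≗h′ =
  cong₂ _+_ (h≗h′ []) (cong₂ _+_ (sumLength≤-cong n (λ u → h≗h′ (X ∷ u))) (sumLength≤-cong n (λ u → h≗h′ (Y ∷ u))))

sumLength≤-+ : ∀ n h h′ → sumLength≤ n (λ u → h u + h′ u) ≡ sumLength≤ n h + sumLength≤ n h′
sumLength≤-+ zero    h h′ = refl
sumLength≤-+ (suc n) h h′ =
  trans (cong ((h [] + h′ []) +_) (cong₂ _+_ (sumLength≤-+ n (λ u → h (X ∷ u)) (λ u → h′ (X ∷ u)))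
                                                (sumLength≤-+ n (λ u → h (Y ∷ u)) (λ u → h′ (Y ∷ u)))))
        (solve 6 (λ a b c d e f → (a :+ b) :+ ((c :+ d) :+ (e :+ f)) := (a :+ (c :+ e)) :+ (b :+ (d :+ f))) refl
          (h []) (h′ []) (sumLength≤ n (λ u → h (X ∷ u))) (sumLength≤ n (λ u → h′ (X ∷ u)))
          (sumLength≤ n (λ u → h (Y ∷ u))) (sumLength≤ n (λ u → h′ (Y ∷ u))))

sumLength≤-zero : ∀ n h → (∀ u → h u ≡ 0ℚ) → sumLength≤ n h ≡ 0ℚ
sumLength≤-zero zero    h h≗0 = h≗0 []
sumLength≤-zero (suc n) h h≗0 =
  trans (cong₂ _+_ (h≗0 []) (cong₂ _+_ (sumLength≤-zero n _ (λ u → h≗0 (X ∷ u)))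
                                        (sumLength≤-zero n _ (λ u → h≗0 (Y ∷ u)))))
        (trans (+-identityˡ _) (+-identityˡ 0ℚ))

sumLength≤-termCoeff : ∀ n u c (G : Word → ℚ) → (n < length u → G u ≡ 0ℚ) →
  sumLength≤ n (λ z → termCoeff u c z * G z) ≡ c * G u
sumLength≤-termCoeff zero    []      c G short = refl
sumLength≤-termCoeff zero    (a ∷ u) c G short =
  trans (*-zeroˡ (G [])) (sym (trans (cong (c *_) (short (s≤s z≤n))) (*-zeroʳ c)))
sumLength≤-termCoeff (suc n) []      c G short =
  trans (cong (c * G [] +_) (trans (cong₂ _+_ (sumLength≤-zero n _ (λ u → *-zeroˡ (G (X ∷ u))))
                                              (sumLength≤-zero n _ (λ u → *-zeroˡ (G (Y ∷ u)))))
                                   (+-identityˡ 0ℚ)))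
        (+-identityʳ _)
sumLength≤-termCoeff (suc n) (X ∷ u) c G short =
  trans (cong₂ _+_ (*-zeroˡ (G [])) (cong₂ _+_
          (trans (sumLength≤-cong n (λ z → cong (_* G (X ∷ z)) (termCoeff-∷ X u c z)))
                 (sumLength≤-termCoeff n u c (λ z → G (X ∷ z)) (λ n<u → short (s≤s n<u))))
          (sumLength≤-zero n _ (λ z → *-zeroˡ (G (Y ∷ z))))))
        (trans (+-identityˡ _) (+-identityʳ _))
sumLength≤-termCoeff (suc n) (Y ∷ u) c G short =
  trans (cong₂ _+_ (*-zeroˡ (G [])) (cong₂ _+_
          (sumLength≤-zero n _ (λ z → *-zeroˡ (G (X ∷ z))))
          (trans (sumLength≤-cong n (λ z → cong (_* G (Y ∷ z)) (termCoeff-∷ Y u c z)))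
                 (sumLength≤-termCoeff n u c (λ z → G (Y ∷ z)) (λ n<u → short (s≤s n<u))))))
        (trans (+-identityˡ _) (+-identityˡ _))

linearExt-as-sum : ∀ n p G → (∀ u → n < length u → G u ≡ 0ℚ) →
  linearExt p G ≡ sumLength≤ n (λ z → coeff p z * G z)
linearExt-as-sum n []            G short = sym (sumLength≤-zero n _ (λ z → *-zeroˡ (G z)))
linearExt-as-sum n ((c , u) ∷ p) G short = sym (trans
  (sumLength≤-cong n (λ z → *-distribʳ-+ (G z) (termCoeff u c z) (coeff p z)))
  (trans (sumLength≤-+ n (λ z → termCoeff u c z * G z) (λ z → coeff p z * G z))
         (cong₂ _+_ (sumLength≤-termCoeff n u c G (short u)) (sym (linearExt-as-sum n p G short)))))

linearExt-≋ : ∀ n {p q} G → (∀ u → n < length u → G u ≡ 0ℚ) → p ≋ q → linearExt p G ≡ linearExt q G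
linearExt-≋ n {p} {q} G short p≋q =
  trans (linearExt-as-sum n p G short)
        (trans (sumLength≤-cong n (λ z → cong (_* G z) (coeff-≡ p≋q z))) (sym (linearExt-as-sum n q G short)))

LengthAtLeast : ℕ → H → Set
LengthAtLeast k = All (λ t → k ≤ length (proj₂ t))

LengthAtLeast-coeff : ∀ {k p} → LengthAtLeast k p → ∀ v → length v < k → coeff p v ≡ 0ℚ
LengthAtLeast-coeff []                       v v<k = refl
LengthAtLeast-coeff {p = (c , u) ∷ p} (k≤u ∷ long) v v<k with u ≟W v
... | yes refl = ⊥-elim (ℕ.<⇒≱ v<k k≤u)
... | no _     = trans (+-identityˡ _) (LengthAtLeast-coeff long v v<k)

LengthAtLeast-· : ∀ {k} c {p} → LengthAtLeast k p → LengthAtLeast k (c · p)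
LengthAtLeast-· c []           = []
LengthAtLeast-· c (k≤u ∷ long) = k≤u ∷ LengthAtLeast-· c long

LengthAtLeast-zero : ∀ p → LengthAtLeast 0 p
LengthAtLeast-zero = universal (λ _ → z≤n)

LengthAtLeast-⊗ : ∀ {a b p q} → LengthAtLeast a p → LengthAtLeast b q → LengthAtLeast (a ℕ.+ b) (p ⊗ q)
LengthAtLeast-⊗ {p = []}          []            longq = []
LengthAtLeast-⊗ {a} {b} {(c , u) ∷ p} (a≤u ∷ longp) longq = ++⁺ (row longq) (LengthAtLeast-⊗ longp longq)
  where
  row : ∀ {q} → LengthAtLeast b q → LengthAtLeast (a ℕ.+ b) (map (λ { (d , v) → (c * d , u ++ v) }) q)
  row []                              = []
  row {(d , v) ∷ q} (b≤v ∷ long) =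
    subst (a ℕ.+ b ≤_) (sym (List.length-++ u)) (ℕ.+-mono-≤ a≤u b≤v) ∷ row long

LengthAtLeast-wordH : ∀ u → LengthAtLeast (length u) (wordH u)
LengthAtLeast-wordH u = ℕ.≤-refl ∷ []

LengthAtLeast-derOnWord : ∀ {dx dy} → LengthAtLeast 1 dx → LengthAtLeast 1 dy →
  ∀ u → LengthAtLeast (length u) (derOnWord dx dy u)
LengthAtLeast-derOnWord longx longy []      = []
LengthAtLeast-derOnWord longx longy (X ∷ u) =
  ++⁺ (LengthAtLeast-⊗ longx (LengthAtLeast-wordH u))
      (LengthAtLeast-⊗ (LengthAtLeast-wordH (X ∷ [])) (LengthAtLeast-derOnWord longx longy u))
LengthAtLeast-derOnWord longx longy (Y ∷ u) =
  ++⁺ (LengthAtLeast-⊗ longy (LengthAtLeast-wordH u))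
      (LengthAtLeast-⊗ (LengthAtLeast-wordH (Y ∷ [])) (LengthAtLeast-derOnWord longx longy u))

record IsDerivation (D : H → H) : Set where
  field
    ≋-cong  : ∀ {p q} → p ≋ q → D p ≋ D q
    ⊕-hom   : ∀ p q → D (p ⊕ q) ≋ D p ⊕ D q
    ·-hom   : ∀ c p → D (c · p) ≋ c · D p
    leibniz : ∀ p q → D (p ⊗ q) ≋ D p ⊗ q ⊕ p ⊗ D q
open IsDerivation

derOnWord-++ : ∀ dx dy u v →
  derOnWord dx dy (u ++ v) ≋ derOnWord dx dy u ⊗ wordH v ⊕ wordH u ⊗ derOnWord dx dy v
derOnWord-++ dx dy []      v = ≋-sym (⊗-identityˡ (derOnWord dx dy v))
derOnWord-++ dx dy (X ∷ u) v =
  ≋-trans (⊕-cong (≋-refl {dx ⊗ wordH (u ++ v)}) (⊗-cong (≋-refl {x}) (derOnWord-++ dx dy u v)))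
          (prove (dx ∷ wordH u ∷ wordH v ∷ x ∷ derOnWord dx dy u ∷ derOnWord dx dy v ∷ [])
                 (V 0 :⊗ (V 1 :⊗ V 2) :⊕ V 3 :⊗ (V 4 :⊗ V 2 :⊕ V 1 :⊗ V 5))
                 ((V 0 :⊗ V 1 :⊕ V 3 :⊗ V 4) :⊗ V 2 :⊕ (V 3 :⊗ V 1) :⊗ V 5) refl)
derOnWord-++ dx dy (Y ∷ u) v =
  ≋-trans (⊕-cong (≋-refl {dy ⊗ wordH (u ++ v)}) (⊗-cong (≋-refl {y}) (derOnWord-++ dx dy u v)))
          (prove (dy ∷ wordH u ∷ wordH v ∷ y ∷ derOnWord dx dy u ∷ derOnWord dx dy v ∷ [])
                 (V 0 :⊗ (V 1 :⊗ V 2) :⊕ V 3 :⊗ (V 4 :⊗ V 2 :⊕ V 1 :⊗ V 5))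
                 ((V 0 :⊗ V 1 :⊕ V 3 :⊗ V 4) :⊗ V 2 :⊕ (V 3 :⊗ V 1) :⊗ V 5) refl)

coeff-derivation : ∀ dx dy p v →
  coeff (derivation dx dy p) v ≡ linearExt p (λ u → coeff (derOnWord dx dy u) v)
coeff-derivation dx dy []            v = refl
coeff-derivation dx dy ((c , u) ∷ p) v =
  trans (coeff-++ (c · derOnWord dx dy u) (derivation dx dy p) v)
        (cong₂ _+_ (coeff-· c (derOnWord dx dy u) v) (coeff-derivation dx dy p v))

derivation-leibniz : ∀ dx dy p q →
  derivation dx dy (p ⊗ q) ≋ derivation dx dy p ⊗ q ⊕ p ⊗ derivation dx dy q
derivation-leibniz dx dy p q = coeffwise λ z → begin
    coeff (D (p ⊗ q)) z
  ≡⟨ coeff-derivation dx dy (p ⊗ q) z ⟩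
    linearExt (p ⊗ q) (G z)
  ≡⟨ linearExt-⊗ p q (G z) ⟩
    linearExt p (λ u → linearExt q (λ v → G z (u ++ v)))
  ≡⟨ linearExt-cong p (λ u → linearExt-cong q (λ v → wordLeibniz u v z)) ⟩
    linearExt p (λ u → linearExt q (λ v → (coeff (Dw u) ⋆ coeff (wordH v)) z + (coeff (wordH u) ⋆ coeff (Dw v)) z))
  ≡⟨ linearExt-cong p (λ u → linearExt-+ q _ _) ⟩
    linearExt p (λ u → linearExt q (λ v → (coeff (Dw u) ⋆ coeff (wordH v)) z)
                     + linearExt q (λ v → (coeff (wordH u) ⋆ coeff (Dw v)) z))
  ≡⟨ linearExt-+ p _ _ ⟩
    linearExt p (λ u → linearExt q (λ v → (coeff (Dw u) ⋆ coeff (wordH v)) z))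
      + linearExt p (λ u → linearExt q (λ v → (coeff (wordH u) ⋆ coeff (Dw v)) z))
  ≡⟨ cong₂ _+_ (linearExt-⋆ p q (λ u → coeff (Dw u)) (λ v → coeff (wordH v)) z)
               (linearExt-⋆ p q (λ u → coeff (wordH u)) (λ v → coeff (Dw v)) z) ⟩
    ((λ w → linearExt p (G w)) ⋆ (λ w → linearExt q (λ v → coeff (wordH v) w))) z
      + ((λ w → linearExt p (λ u → coeff (wordH u) w)) ⋆ (λ w → linearExt q (G w))) z
  ≡⟨ sym (cong₂ _+_ (⋆-cong (coeff-derivation dx dy p) (coeff-as-linearExt q) z)
                    (⋆-cong (coeff-as-linearExt p) (coeff-derivation dx dy q) z)) ⟩
    (coeff (D p) ⋆ coeff q) z + (coeff p ⋆ coeff (D q)) z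
  ≡⟨ sym (cong₂ _+_ (coeff-⊗ (D p) q z) (coeff-⊗ p (D q) z)) ⟩
    coeff (D p ⊗ q) z + coeff (p ⊗ D q) z
  ≡⟨ sym (coeff-++ (D p ⊗ q) (p ⊗ D q) z) ⟩
    coeff (D p ⊗ q ⊕ p ⊗ D q) z
  ∎
  where
  open ≡-Reasoning

  D : H → H
  D = derivation dx dy

  Dw : Word → H
  Dw = derOnWord dx dy

  G : Word → Word → ℚ
  G z u = coeff (Dw u) z

  wordLeibniz : ∀ u v z →
    G z (u ++ v) ≡ (coeff (Dw u) ⋆ coeff (wordH v)) z + (coeff (wordH u) ⋆ coeff (Dw v)) z
  wordLeibniz u v z =
    trans (coeff-≡ (derOnWord-++ dx dy u v) z)
          (trans (coeff-++ (Dw u ⊗ wordH v) (wordH u ⊗ Dw v) z)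
                 (cong₂ _+_ (coeff-⊗ (Dw u) (wordH v) z) (coeff-⊗ (wordH u) (Dw v) z)))

-- The values dx, dy have no constant term, so a word u only contributes to
-- coefficients of words of length ≥ |u|; this makes derivation dx dy respect ≋.
derivation-≋-cong : ∀ {dx dy} → LengthAtLeast 1 dx → LengthAtLeast 1 dy →
  ∀ {p q} → p ≋ q → derivation dx dy p ≋ derivation dx dy q
derivation-≋-cong {dx} {dy} longx longy {p} {q} p≋q = coeffwise λ z →
  trans (coeff-derivation dx dy p z)
        (trans (linearExt-≋ (length z) (G z) (short z) p≋q) (sym (coeff-derivation dx dy q z)))
  where
  G : Word → Word → ℚ
  G z u = coeff (derOnWord dx dy u) z

  short : ∀ z u → length z < length u → G z u ≡ 0ℚ
  short z u z<u = LengthAtLeast-coeff (LengthAtLeast-derOnWord longx longy u) z z<u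

derivation-isDerivation : ∀ {dx dy} → LengthAtLeast 1 dx → LengthAtLeast 1 dy →
  IsDerivation (derivation dx dy)
derivation-isDerivation {dx} {dy} longx longy = record
  { ≋-cong  = derivation-≋-cong longx longy
  ; ⊕-hom   = λ p q → ≡⇒≋ (List.concatMap-++ _ p q)
  ; ·-hom   = λ c p → coeffwise λ z →
      trans (coeff-derivation dx dy (c · p) z)
            (trans (linearExt-· c p (λ u → coeff (derOnWord dx dy u) z))
                   (sym (trans (coeff-· c (derivation dx dy p) z) (cong (c *_) (coeff-derivation dx dy p z)))))
  ; leibniz = derivation-leibniz dx dy
  }

module _ {D : H → H} (isD : IsDerivation D) where

  derivation-zeroH : D zeroH ≋ zeroH
  derivation-zeroH = ≋-trans (·-hom isD 0ℚ zeroH) (·-zeroˡ (D zeroH))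

  -- D 1 = D (1 ⊗ 1) = D 1 ⊕ D 1, and t = t + t forces t = 0 in ℚ.
  derivation-oneH : D oneH ≋ zeroH
  derivation-oneH = coeffwise λ w → double≡⇒0 (trans
    (coeff-≡ (≋-trans (≋-cong isD (≋-sym (⊗-identityˡ oneH)))
             (≋-trans (leibniz isD oneH oneH) (⊕-cong (⊗-identityʳ (D oneH)) (⊗-identityˡ (D oneH))))) w)
    (coeff-++ (D oneH) (D oneH) w))
    where
    double≡⇒0 : ∀ {t} → t ≡ t + t → t ≡ 0ℚ
    double≡⇒0 {t} t≡2t = begin
      t               ≡⟨ solve 1 (λ a → a := (a :+ a) :+ (+-*-Solver.:- a)) refl t ⟩
      (t + t) + (- t) ≡⟨ cong (_+ (- t)) (sym t≡2t) ⟩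
      t + (- t)       ≡⟨ +-inverseʳ t ⟩
      0ℚ              ∎
      where open ≡-Reasoning

commutator-isDerivation : ∀ {A B} → IsDerivation A → IsDerivation B → IsDerivation ⟦ A , B ⟧
commutator-isDerivation {A} {B} isA isB = record
  { ≋-cong  = λ p≋q → ⊕-cong (≋-cong isA (≋-cong isB p≋q)) (·-cong (- 1ℚ) (≋-cong isB (≋-cong isA p≋q)))
  ; ⊕-hom   = λ p q → ≋-trans
      (⊕-cong (≋-trans (≋-cong isA (⊕-hom isB p q)) (⊕-hom isA (B p) (B q)))
              (·-cong (- 1ℚ) (≋-trans (≋-cong isB (⊕-hom isA p q)) (⊕-hom isB (A p) (A q)))))
      (prove (A (B p) ∷ A (B q) ∷ B (A p) ∷ B (A q) ∷ [])
             (V 0 :⊕ V 1 :⊖ (V 2 :⊕ V 3)) ((V 0 :⊖ V 2) :⊕ (V 1 :⊖ V 3)) refl)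
  ; ·-hom   = λ c p → ≋-trans
      (⊕-cong (≋-trans (≋-cong isA (·-hom isB c p)) (·-hom isA c (B p)))
              (≋-trans (·-cong (- 1ℚ) (≋-trans (≋-cong isB (·-hom isA c p)) (·-hom isB c (A p))))
                       (·-comm (- 1ℚ) c (B (A p)))))
      (≋-sym (·-distribˡ c (A (B p)) ((- 1ℚ) · B (A p))))
  ; leibniz = λ p q → ≋-trans
      (⊕-cong (≋-trans (≋-cong isA (leibniz isB p q))
                (≋-trans (⊕-hom isA (B p ⊗ q) (p ⊗ B q)) (⊕-cong (leibniz isA (B p) q) (leibniz isA p (B q)))))
              (·-cong (- 1ℚ) (≋-trans (≋-cong isB (leibniz isA p q))
                (≋-trans (⊕-hom isB (A p ⊗ q) (p ⊗ A q)) (⊕-cong (leibniz isB (A p) q) (leibniz isB p (A q)))))))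
      (prove (A (B p) ∷ B (A p) ∷ A p ∷ B p ∷ A q ∷ B q ∷ A (B q) ∷ B (A q) ∷ p ∷ q ∷ [])
             ((V 0 :⊗ V 9 :⊕ V 3 :⊗ V 4) :⊕ (V 2 :⊗ V 5 :⊕ V 8 :⊗ V 6) :⊖
              ((V 1 :⊗ V 9 :⊕ V 2 :⊗ V 5) :⊕ (V 3 :⊗ V 4 :⊕ V 8 :⊗ V 7)))
             ((V 0 :⊖ V 1) :⊗ V 9 :⊕ V 8 :⊗ (V 6 :⊖ V 7)) refl)
  }

⊕-isDerivation : ∀ {A B} → IsDerivation A → IsDerivation B → IsDerivation (λ p → A p ⊕ B p)
⊕-isDerivation {A} {B} isA isB = record
  { ≋-cong  = λ p≋q → ⊕-cong (≋-cong isA p≋q) (≋-cong isB p≋q)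
  ; ⊕-hom   = λ p q → ≋-trans (⊕-cong (⊕-hom isA p q) (⊕-hom isB p q))
      (prove (A p ∷ A q ∷ B p ∷ B q ∷ []) ((V 0 :⊕ V 1) :⊕ (V 2 :⊕ V 3)) ((V 0 :⊕ V 2) :⊕ (V 1 :⊕ V 3)) refl)
  ; ·-hom   = λ c p → ≋-trans (⊕-cong (·-hom isA c p) (·-hom isB c p)) (≋-sym (·-distribˡ c (A p) (B p)))
  ; leibniz = λ p q → ≋-trans (⊕-cong (leibniz isA p q) (leibniz isB p q))
      (prove (A p ∷ A q ∷ B p ∷ B q ∷ p ∷ q ∷ [])
             ((V 0 :⊗ V 5 :⊕ V 4 :⊗ V 1) :⊕ (V 2 :⊗ V 5 :⊕ V 4 :⊗ V 3))
             ((V 0 :⊕ V 2) :⊗ V 5 :⊕ V 4 :⊗ (V 1 :⊕ V 3)) refl)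
  }

·-isDerivation : ∀ {A} c → IsDerivation A → IsDerivation (λ p → c · A p)
·-isDerivation {A} c isA = record
  { ≋-cong  = λ p≋q → ·-cong c (≋-cong isA p≋q)
  ; ⊕-hom   = λ p q → ≋-trans (·-cong c (⊕-hom isA p q)) (·-distribˡ c (A p) (A q))
  ; ·-hom   = λ d p → ≋-trans (·-cong c (·-hom isA d p)) (·-comm c d (A p))
  ; leibniz = λ p q → ≋-trans (·-cong c (leibniz isA p q))
      (≋-trans (·-distribˡ c (A p ⊗ q) (p ⊗ A q)) (≋-sym (⊕-cong (⊗-·ˡ c (A p) q) (⊗-·ʳ c p (A q)))))
  }

zero-isDerivation : IsDerivation (λ _ → zeroH)
zero-isDerivation = record
  { ≋-cong  = λ _ → ≋-refl
  ; ⊕-hom   = λ _ _ → ≋-refl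
  ; ·-hom   = λ _ _ → ≋-refl
  ; leibniz = λ p _ → ≋-sym (⊗-zeroʳ p)
  }

sumFrom1-isDerivation : ∀ n f → (∀ j → IsDerivation (f j)) → IsDerivation (sumFrom1 n f)
sumFrom1-isDerivation zero    f isf = zero-isDerivation
sumFrom1-isDerivation (suc n) f isf = ⊕-isDerivation (sumFrom1-isDerivation n f isf) (isf (suc n))

derivation-ext : ∀ {A B} → IsDerivation A → IsDerivation B → A x ≋ B x → A y ≋ B y → ∀ p → A p ≋ B p
derivation-ext {A} {B} isA isB Ax≋Bx Ay≋By = onH
  where
  onLetter : ∀ a u → A (wordH u) ≋ B (wordH u) → A (wordH (a ∷ u)) ≋ B (wordH (a ∷ u))
  onLetter a u IH = ≋-trans (leibniz isA (wordH (a ∷ [])) (wordH u))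
    (≋-trans (⊕-cong (⊗-cong (onGenerator a) (≋-refl {wordH u})) (⊗-cong (≋-refl {wordH (a ∷ [])}) IH))
             (≋-sym (leibniz isB (wordH (a ∷ [])) (wordH u))))
    where
    onGenerator : ∀ a → A (wordH (a ∷ [])) ≋ B (wordH (a ∷ []))
    onGenerator X = Ax≋Bx
    onGenerator Y = Ay≋By

  onWord : ∀ u → A (wordH u) ≋ B (wordH u)
  onWord []      = ≋-trans (derivation-oneH isA) (≋-sym (derivation-oneH isB))
  onWord (a ∷ u) = onLetter a u (onWord u)

  term : ∀ c u p → ((c , u) ∷ p) ≋ c · wordH u ⊕ p
  term c u p = coeffwise λ w → cong (λ t → termCoeff u t w + coeff p w) (sym (*-identityʳ c))

  onH : ∀ p → A p ≋ B p
  onH []            = ≋-trans (derivation-zeroH isA) (≋-sym (derivation-zeroH isB))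
  onH ((c , u) ∷ p) = begin
    A ((c , u) ∷ p)        ≈⟨ ≋-cong isA (term c u p) ⟩
    A (c · wordH u ⊕ p)    ≈⟨ ⊕-hom isA (c · wordH u) p ⟩
    A (c · wordH u) ⊕ A p  ≈⟨ ⊕-cong (·-hom isA c (wordH u)) (onH p) ⟩
    c · A (wordH u) ⊕ B p  ≈⟨ ⊕-cong (·-cong c (onWord u)) ≋-refl ⟩
    c · B (wordH u) ⊕ B p  ≈⟨ ⊕-cong (·-hom isB c (wordH u)) ≋-refl ⟨
    B (c · wordH u) ⊕ B p  ≈⟨ ⊕-hom isB (c · wordH u) p ⟨
    B (c · wordH u ⊕ p)    ≈⟨ ≋-cong isB (term c u p) ⟨
    B ((c , u) ∷ p)        ∎
    where open ≋-Reasoning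

S : H
S = x ⊕ y

δvalue ∂value : ℕ → H
δvalue j = y ⊗ x ^ (j ∸ 1) ⊗ S
∂value k = y ⊗ S ^ (k ∸ 1) ⊗ x

LengthAtLeast-y⊗ : ∀ p q → LengthAtLeast 1 (y ⊗ p ⊗ q)
LengthAtLeast-y⊗ p q =
  LengthAtLeast-⊗ (LengthAtLeast-⊗ (LengthAtLeast-wordH (Y ∷ [])) (LengthAtLeast-zero p)) (LengthAtLeast-zero q)

δ-isDerivation : ∀ j → IsDerivation (δ j)
δ-isDerivation j = derivation-isDerivation [] (LengthAtLeast-y⊗ (x ^ (j ∸ 1)) S)

∂-isDerivation : ∀ k → IsDerivation (∂ k)
∂-isDerivation k =
  derivation-isDerivation (LengthAtLeast-y⊗ (S ^ (k ∸ 1)) x) (LengthAtLeast-· (- 1ℚ) (LengthAtLeast-y⊗ (S ^ (k ∸ 1)) x))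

derivation-x : ∀ dx dy → derivation dx dy x ≋ dx
derivation-x dx dy = begin
  (1ℚ · (dx ⊗ oneH ⊕ x ⊗ zeroH)) ⊕ zeroH  ≈⟨ ⊕-identityʳ _ ⟩
  1ℚ · (dx ⊗ oneH ⊕ x ⊗ zeroH)            ≈⟨ ·-identityˡ _ ⟩
  dx ⊗ oneH ⊕ x ⊗ zeroH                   ≈⟨ ⊕-cong (⊗-identityʳ dx) (⊗-zeroʳ x) ⟩
  dx ⊕ zeroH                              ≈⟨ ⊕-identityʳ dx ⟩
  dx                                      ∎
  where open ≋-Reasoning

derivation-y : ∀ dx dy → derivation dx dy y ≋ dy
derivation-y dx dy = begin
  (1ℚ · (dy ⊗ oneH ⊕ y ⊗ zeroH)) ⊕ zeroH  ≈⟨ ⊕-identityʳ _ ⟩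
  1ℚ · (dy ⊗ oneH ⊕ y ⊗ zeroH)            ≈⟨ ·-identityˡ _ ⟩
  dy ⊗ oneH ⊕ y ⊗ zeroH                   ≈⟨ ⊕-cong (⊗-identityʳ dy) (⊗-zeroʳ y) ⟩
  dy ⊕ zeroH                              ≈⟨ ⊕-identityʳ dy ⟩
  dy                                      ∎
  where open ≋-Reasoning

δ-x : ∀ j → δ j x ≋ zeroH
δ-x j = derivation-x zeroH (δvalue j)

δ-y : ∀ j → δ j y ≋ δvalue j
δ-y j = derivation-y zeroH (δvalue j)

∂-x : ∀ k → ∂ k x ≋ ∂value k
∂-x k = derivation-x (∂value k) ((- 1ℚ) · ∂value k)

∂-y : ∀ k → ∂ k y ≋ (- 1ℚ) · ∂value k
∂-y k = derivation-y (∂value k) ((- 1ℚ) · ∂value k)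

δ-S : ∀ j → δ j S ≋ δvalue j
δ-S j = ≋-trans (⊕-hom (δ-isDerivation j) x y) (⊕-cong (δ-x j) (δ-y j))

∂-S : ∀ k → ∂ k S ≋ zeroH
∂-S k = ≋-trans (⊕-hom (∂-isDerivation k) x y)
  (≋-trans (⊕-cong (∂-x k) (∂-y k)) (prove (∂value k ∷ []) (V 0 :⊕ (- 1ℚ) :· V 0) :0 refl))

-- insertions A B n = Σ_{a < n} A ^ a ⊗ B ⊗ A ^ (n - 1 - a)
insertions : H → H → ℕ → H
insertions A B zero    = zeroH
insertions A B (suc n) = B ⊗ A ^ n ⊕ insertions A (A ⊗ B) n

insertions-cong : ∀ A {B B′} → B ≋ B′ → ∀ n → insertions A B n ≋ insertions A B′ n
insertions-cong A B≋B′ zero    = ≋-refl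
insertions-cong A B≋B′ (suc n) =
  ⊕-cong (⊗-cong B≋B′ ≋-refl) (insertions-cong A (⊗-cong (≋-refl {A}) B≋B′) n)

insertions-⊕ : ∀ A B C n → insertions A (B ⊕ C) n ≋ insertions A B n ⊕ insertions A C n
insertions-⊕ A B C zero    = ≋-refl
insertions-⊕ A B C (suc n) = begin
    (B ⊕ C) ⊗ A ^ n ⊕ insertions A (A ⊗ (B ⊕ C)) n
  ≈⟨ ⊕-cong (⊗-distribʳ (A ^ n) B C)
            (≋-trans (insertions-cong A (⊗-distribˡ A B C) n) (insertions-⊕ A (A ⊗ B) (A ⊗ C) n)) ⟩
    (B ⊗ A ^ n ⊕ C ⊗ A ^ n) ⊕ (insertions A (A ⊗ B) n ⊕ insertions A (A ⊗ C) n)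
  ≈⟨ ⊕-interchange (B ⊗ A ^ n) (C ⊗ A ^ n) (insertions A (A ⊗ B) n) (insertions A (A ⊗ C) n) ⟩
    (B ⊗ A ^ n ⊕ insertions A (A ⊗ B) n) ⊕ (C ⊗ A ^ n ⊕ insertions A (A ⊗ C) n)
  ∎
  where open ≋-Reasoning

⊗-insertions : ∀ A B n → A ⊗ insertions A B n ≋ insertions A (A ⊗ B) n
⊗-insertions A B zero    = ⊗-zeroʳ A
⊗-insertions A B (suc n) =
  ≋-trans (⊗-distribˡ A (B ⊗ A ^ n) (insertions A (A ⊗ B) n))
          (⊕-cong (≋-sym (⊗-assoc A B (A ^ n))) (⊗-insertions A (A ⊗ B) n))

derivation-^ : ∀ {D} → IsDerivation D → ∀ A n → D (A ^ n) ≋ insertions A (D A) n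
derivation-^ isD A zero    = derivation-oneH isD
derivation-^ {D} isD A (suc n) = begin
  D (A ⊗ A ^ n)                                 ≈⟨ leibniz isD A (A ^ n) ⟩
  D A ⊗ A ^ n ⊕ A ⊗ D (A ^ n)                   ≈⟨ ⊕-cong (≋-refl {D A ⊗ A ^ n}) (⊗-cong (≋-refl {A}) (derivation-^ isD A n)) ⟩
  D A ⊗ A ^ n ⊕ A ⊗ insertions A (D A) n        ≈⟨ ⊕-cong (≋-refl {D A ⊗ A ^ n}) (⊗-insertions A (D A) n) ⟩
  D A ⊗ A ^ n ⊕ insertions A (A ⊗ D A) n        ∎
  where open ≋-Reasoning

^-+ : ∀ A m n → A ^ m ⊗ A ^ n ≋ A ^ (m ℕ.+ n)
^-+ A zero    n = ⊗-identityˡ (A ^ n)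
^-+ A (suc m) n = ≋-trans (⊗-assoc A (A ^ m) (A ^ n)) (⊗-cong (≋-refl {A}) (^-+ A m n))

ℕtoℚ-suc : ∀ n → ℕtoℚ (suc n) ≡ 1ℚ + ℕtoℚ n
ℕtoℚ-suc n = ℚ.toℚᵘ-injective (begin
    toℚᵘ (ℕtoℚ (suc n))                  ≈⟨ ℚ.toℚᵘ-fromℚᵘ (mkℚᵘ (ℤ.+ suc n) 0) ⟩
    mkℚᵘ (ℤ.+ suc n) 0                      ≈⟨ *≡* (Z.solve 1 (λ a → (one Z.:+ a) Z.:* (one Z.:* one) Z.:= (one Z.:* one Z.:+ a Z.:* one) Z.:* one)
                                                         refl (ℤ.+ n)) ⟩
    toℚᵘ 1ℚ ℚᵘ.+ mkℚᵘ (ℤ.+ n) 0          ≈⟨ ℚᵘ.+-cong (ℚᵘ.≃-refl {toℚᵘ 1ℚ}) (ℚ.toℚᵘ-fromℚᵘ (mkℚᵘ (ℤ.+ n) 0)) ⟨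
    toℚᵘ 1ℚ ℚᵘ.+ toℚᵘ (ℕtoℚ n)         ≈⟨ ℚ.toℚᵘ-homo-+ 1ℚ (ℕtoℚ n) ⟨
    toℚᵘ (1ℚ + ℕtoℚ n)                   ∎)
  where
  open ℚᵘ.≃-Reasoning
  module Z = Data.Integer.Solver.+-*-Solver

  one : Z.Polynomial 1
  one = Z.con (ℤ.+ 1)

insertions-power : ∀ A k n → insertions A (A ^ suc k) n ≋ ℕtoℚ n · A ^ (k ℕ.+ n)
insertions-power A k zero    = ≋-sym (·-zeroˡ (A ^ (k ℕ.+ 0)))
insertions-power A k (suc n) = begin
    A ^ suc k ⊗ A ^ n ⊕ insertions A (A ^ suc (suc k)) n
  ≈⟨ ⊕-cong (^-+ A (suc k) n) (insertions-power A (suc k) n) ⟩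
    A ^ suc (k ℕ.+ n) ⊕ ℕtoℚ n · A ^ suc (k ℕ.+ n)
  ≈⟨ ⊕-cong (·-identityˡ (A ^ suc (k ℕ.+ n))) (≋-refl {ℕtoℚ n · A ^ suc (k ℕ.+ n)}) ⟨
    1ℚ · A ^ suc (k ℕ.+ n) ⊕ ℕtoℚ n · A ^ suc (k ℕ.+ n)
  ≈⟨ ·-distribʳ 1ℚ (ℕtoℚ n) _ ⟨
    (1ℚ + ℕtoℚ n) · A ^ suc (k ℕ.+ n)
  ≡⟨ cong₂ (λ c e → c · A ^ e) (sym (ℕtoℚ-suc n)) (sym (ℕ.+-suc k n)) ⟩
    ℕtoℚ (suc n) · A ^ (k ℕ.+ suc n)
  ∎
  where open ≋-Reasoning

xTerm yTerm : ℕ → ℕ → H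
xTerm i N = y ⊗ insertions S (x ^ i ⊗ S) N ⊗ x
yTerm c i = y ⊗ insertions x (S ^ c ⊗ x) i ⊗ S

insertions-S⊗ : ∀ A B n → insertions A (S ⊗ B) n ≋ insertions A (x ⊗ B) n ⊕ insertions A (y ⊗ B) n
insertions-S⊗ A B n = ≋-trans (insertions-cong A (⊗-distribʳ B x y) n) (insertions-⊕ A (x ⊗ B) (y ⊗ B) n)

δ-∂value : ∀ i N → δ (suc i) (∂value (suc N)) ≋ xTerm i (suc N) ⊖ xTerm (suc i) N
δ-∂value i N = begin
    δ (suc i) (y ⊗ S ^ N ⊗ x)
  ≈⟨ leibniz isδ (y ⊗ S ^ N) x ⟩
    δ (suc i) (y ⊗ S ^ N) ⊗ x ⊕ (y ⊗ S ^ N) ⊗ δ (suc i) x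
  ≈⟨ ⊕-cong (⊗-cong (leibniz isδ y (S ^ N)) (≋-refl {x})) (⊗-cong (≋-refl {y ⊗ S ^ N}) (δ-x (suc i))) ⟩
    (δ (suc i) y ⊗ S ^ N ⊕ y ⊗ δ (suc i) (S ^ N)) ⊗ x ⊕ (y ⊗ S ^ N) ⊗ zeroH
  ≈⟨ ⊕-cong (⊗-cong (⊕-cong (⊗-cong (δ-y (suc i)) (≋-refl {S ^ N})) (⊗-cong (≋-refl {y}) δ[S^N])) (≋-refl {x}))
            (≋-refl {(y ⊗ S ^ N) ⊗ zeroH}) ⟩
    (δvalue (suc i) ⊗ S ^ N ⊕ y ⊗ I₂) ⊗ x ⊕ (y ⊗ S ^ N) ⊗ zeroH
  ≈⟨ prove (x ∷ y ∷ x ^ i ∷ S ^ N ∷ I₁ ∷ I₂ ∷ [])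
           ((((V 1 :⊗ V 2) :⊗ (V 0 :⊕ V 1)) :⊗ V 3 :⊕ V 1 :⊗ V 5) :⊗ V 0 :⊕ (V 1 :⊗ V 3) :⊗ :0)
           (V 1 :⊗ ((V 2 :⊗ (V 0 :⊕ V 1)) :⊗ V 3 :⊕ (V 4 :⊕ V 5)) :⊗ V 0 :⊖ V 1 :⊗ V 4 :⊗ V 0) refl ⟩
    y ⊗ ((x ^ i ⊗ S) ⊗ S ^ N ⊕ (I₁ ⊕ I₂)) ⊗ x ⊖ y ⊗ I₁ ⊗ x
  ≈⟨ ⊕-cong (⊗-cong (⊗-cong (≋-refl {y}) (⊕-cong (≋-refl {(x ^ i ⊗ S) ⊗ S ^ N}) (insertions-S⊗ S (x ^ i ⊗ S) N)))
                    (≋-refl {x}))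
            (·-cong (- 1ℚ) (⊗-cong (⊗-cong (≋-refl {y}) (insertions-cong S (⊗-assoc x (x ^ i) S) N)) (≋-refl {x}))) ⟨
    xTerm i (suc N) ⊖ xTerm (suc i) N
  ∎
  where
  open ≋-Reasoning
  isδ : IsDerivation (δ (suc i))
  isδ = δ-isDerivation (suc i)

  I₁ I₂ : H
  I₁ = insertions S (x ⊗ (x ^ i ⊗ S)) N
  I₂ = insertions S (y ⊗ (x ^ i ⊗ S)) N

  δ[S^N] : δ (suc i) (S ^ N) ≋ I₂
  δ[S^N] = ≋-trans (derivation-^ isδ S N) (insertions-cong S (≋-trans (δ-S (suc i)) (⊗-assoc y (x ^ i) S)) N)

∂[yx^]⊗S : ∀ c i → ∂ (suc c) (y ⊗ x ^ i) ⊗ S ≋ yTerm (suc c) i ⊖ yTerm c (suc i)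
∂[yx^]⊗S c i = begin
    ∂ (suc c) (y ⊗ x ^ i) ⊗ S
  ≈⟨ ⊗-cong (leibniz is∂ y (x ^ i)) (≋-refl {S}) ⟩
    (∂ (suc c) y ⊗ x ^ i ⊕ y ⊗ ∂ (suc c) (x ^ i)) ⊗ S
  ≈⟨ ⊗-cong (⊕-cong (⊗-cong (∂-y (suc c)) (≋-refl {x ^ i})) (⊗-cong (≋-refl {y}) ∂[x^i])) (≋-refl {S}) ⟩
    ((- 1ℚ) · ∂value (suc c) ⊗ x ^ i ⊕ y ⊗ J₂) ⊗ S
  ≈⟨ prove (x ∷ y ∷ S ^ c ∷ x ^ i ∷ J₁ ∷ J₂ ∷ [])
           (((- 1ℚ) :· ((V 1 :⊗ V 2) :⊗ V 0) :⊗ V 3 :⊕ V 1 :⊗ V 5) :⊗ (V 0 :⊕ V 1))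
           (V 1 :⊗ (V 4 :⊕ V 5) :⊗ (V 0 :⊕ V 1) :⊖ V 1 :⊗ ((V 2 :⊗ V 0) :⊗ V 3 :⊕ V 4) :⊗ (V 0 :⊕ V 1)) refl ⟩
    y ⊗ (J₁ ⊕ J₂) ⊗ S ⊖ y ⊗ ((S ^ c ⊗ x) ⊗ x ^ i ⊕ J₁) ⊗ S
  ≈⟨ ⊕-cong (⊗-cong (⊗-cong (≋-refl {y}) split) (≋-refl {S})) (≋-refl {(- 1ℚ) · yTerm c (suc i)}) ⟨
    yTerm (suc c) i ⊖ yTerm c (suc i)
  ∎
  where
  open ≋-Reasoning
  is∂ : IsDerivation (∂ (suc c))
  is∂ = ∂-isDerivation (suc c)

  J₁ J₂ : H
  J₁ = insertions x (x ⊗ (S ^ c ⊗ x)) i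
  J₂ = insertions x (∂value (suc c)) i


  ∂[x^i] : ∂ (suc c) (x ^ i) ≋ J₂
  ∂[x^i] = ≋-trans (derivation-^ is∂ x i) (insertions-cong x (∂-x (suc c)) i)

  split : insertions x (S ^ suc c ⊗ x) i ≋ J₁ ⊕ J₂
  split = ≋-trans (insertions-cong x (⊗-assoc S (S ^ c) x) i)
                  (≋-trans (insertions-S⊗ x (S ^ c ⊗ x) i)
                           (⊕-cong (≋-refl {J₁}) (insertions-cong x (≋-sym (⊗-assoc y (S ^ c) x)) i)))

commutator-x : ∀ i N → ⟦ δ (suc i) , ∂ (suc N) ⟧ x ≋ xTerm i (suc N) ⊖ xTerm (suc i) N
commutator-x i N = begin
    δ (suc i) (∂ (suc N) x) ⊖ ∂ (suc N) (δ (suc i) x)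
  ≈⟨ ⊕-cong (≋-cong (δ-isDerivation (suc i)) (∂-x (suc N)))
            (·-cong (- 1ℚ) (≋-cong (∂-isDerivation (suc N)) (δ-x (suc i)))) ⟩
    δ (suc i) (∂value (suc N)) ⊖ zeroH
  ≈⟨ ⊕-identityʳ _ ⟩
    δ (suc i) (∂value (suc N))
  ≈⟨ δ-∂value i N ⟩
    xTerm i (suc N) ⊖ xTerm (suc i) N
  ∎
  where open ≋-Reasoning

commutator-y : ∀ i c → ⟦ δ (suc i) , ∂ (suc c) ⟧ y ≋
  (- 1ℚ) · (xTerm i (suc c) ⊖ xTerm (suc i) c) ⊖ (yTerm (suc c) i ⊖ yTerm c (suc i))
commutator-y i c = begin
    δ (suc i) (∂ (suc c) y) ⊖ ∂ (suc c) (δ (suc i) y)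
  ≈⟨ ⊕-cong (≋-cong isδ (∂-y (suc c))) (·-cong (- 1ℚ) (≋-cong is∂ (δ-y (suc i)))) ⟩
    δ (suc i) ((- 1ℚ) · ∂value (suc c)) ⊖ ∂ (suc c) ((y ⊗ x ^ i) ⊗ S)
  ≈⟨ ⊕-cong (·-hom isδ (- 1ℚ) (∂value (suc c)))
            (·-cong (- 1ℚ) (≋-trans (leibniz is∂ (y ⊗ x ^ i) S) (⊕-cong (≋-refl {∂ (suc c) (y ⊗ x ^ i) ⊗ S}) (⊗-cong (≋-refl {y ⊗ x ^ i}) (∂-S (suc c)))))) ⟩
    (- 1ℚ) · δ (suc i) (∂value (suc c)) ⊖ (∂ (suc c) (y ⊗ x ^ i) ⊗ S ⊕ (y ⊗ x ^ i) ⊗ zeroH)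
  ≈⟨ ⊕-cong (·-cong (- 1ℚ) (δ-∂value i c))
            (·-cong (- 1ℚ) (≋-trans (⊕-cong (∂[yx^]⊗S c i) (⊗-zeroʳ (y ⊗ x ^ i))) (⊕-identityʳ _))) ⟩
    (- 1ℚ) · (xTerm i (suc c) ⊖ xTerm (suc i) c) ⊖ (yTerm (suc c) i ⊖ yTerm c (suc i))
  ∎
  where
  open ≋-Reasoning
  isδ : IsDerivation (δ (suc i))
  isδ = δ-isDerivation (suc i)

  is∂ : IsDerivation (∂ (suc c))
  is∂ = ∂-isDerivation (suc c)

sumFrom1-telescope : ∀ n f p (T : ℕ → H) →
  (∀ i → suc i ≤ n → f (suc i) p ≋ T i ⊖ T (suc i)) → sumFrom1 n f p ≋ T 0 ⊖ T n
sumFrom1-telescope zero    f p T step = prove (T 0 ∷ []) :0 (V 0 :⊖ V 0) refl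
sumFrom1-telescope (suc n) f p T step = begin
    sumFrom1 n f p ⊕ f (suc n) p
  ≈⟨ ⊕-cong (sumFrom1-telescope n f p T (λ i i<n → step i (ℕ.m≤n⇒m≤1+n i<n))) (step n ℕ.≤-refl) ⟩
    (T 0 ⊖ T n) ⊕ (T n ⊖ T (suc n))
  ≈⟨ prove (T 0 ∷ T n ∷ T (suc n) ∷ []) ((V 0 :⊖ V 1) :⊕ (V 1 :⊖ V 2)) (V 0 :⊖ V 2) refl ⟩
    T 0 ⊖ T (suc n)
  ∎
  where open ≋-Reasoning

sandwich-insertions : ∀ L A R n → L ⊗ insertions A (oneH ⊗ A) n ⊗ R ≋ ℕtoℚ n · (L ⊗ A ^ n ⊗ R)
sandwich-insertions L A R n = begin
    L ⊗ insertions A (oneH ⊗ A) n ⊗ R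
  ≈⟨ ⊗-cong (⊗-cong (≋-refl {L}) (insertions-cong A (≋-trans (⊗-identityˡ A) (≋-sym (⊗-identityʳ A))) n)) (≋-refl {R}) ⟩
    L ⊗ insertions A (A ^ 1) n ⊗ R
  ≈⟨ ⊗-cong (⊗-cong (≋-refl {L}) (insertions-power A 0 n)) (≋-refl {R}) ⟩
    L ⊗ (ℕtoℚ n · A ^ n) ⊗ R
  ≈⟨ ≋-trans (⊗-cong (⊗-·ʳ (ℕtoℚ n) L (A ^ n)) (≋-refl {R})) (⊗-·ˡ (ℕtoℚ n) (L ⊗ A ^ n) R) ⟩
    ℕtoℚ n · (L ⊗ A ^ n ⊗ R)
  ∎
  where open ≋-Reasoning

module _ (M : ℕ) where

  summand : ℕ → H → H
  summand j = ⟦ δ j , ∂ (suc M ∸ j) ⟧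

  Tx Ty : ℕ → H
  Tx j = xTerm j (M ∸ j)
  Ty j = (- 1ℚ) · xTerm j (M ∸ j) ⊖ yTerm (M ∸ j) j

  -- For j = suc i ≤ M, the index suc M ∸ j reduces to M ∸ i, which is suc (M ∸ j).
  summand-x : ∀ i → suc i ≤ M → summand (suc i) x ≋ Tx i ⊖ Tx (suc i)
  summand-x i i<M rewrite ℕ.+-∸-assoc 1 i<M = commutator-x i (M ∸ suc i)

  summand-y : ∀ i → suc i ≤ M → summand (suc i) y ≋ Ty i ⊖ Ty (suc i)
  summand-y i i<M rewrite ℕ.+-∸-assoc 1 i<M =
    ≋-trans (commutator-y i c)
            (prove (xTerm i (suc c) ∷ xTerm (suc i) c ∷ yTerm (suc c) i ∷ yTerm c (suc i) ∷ [])
                   ((- 1ℚ) :· (V 0 :⊖ V 1) :⊖ (V 2 :⊖ V 3))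
                   (((- 1ℚ) :· V 0 :⊖ V 2) :⊖ ((- 1ℚ) :· V 1 :⊖ V 3)) refl)
    where
    c : ℕ
    c = M ∸ suc i

  sum-x : sumFrom1 M summand x ≋ ℕtoℚ M · (∂ (suc M) x ⊕ δ (suc M) x)
  sum-x = begin
      sumFrom1 M summand x
    ≈⟨ sumFrom1-telescope M summand x Tx summand-x ⟩
      xTerm 0 M ⊖ xTerm M (M ∸ M)
    ≈⟨ ⊕-cong (sandwich-insertions y S x M) (≡⇒≋ (cong (λ k → (- 1ℚ) · xTerm M k) (ℕ.n∸n≡0 M))) ⟩
      ℕtoℚ M · ∂value (suc M) ⊖ y ⊗ zeroH ⊗ x
    ≈⟨ ⊕-cong (≋-refl {ℕtoℚ M · ∂value (suc M)}) (prove (x ∷ y ∷ []) ((- 1ℚ) :· (V 1 :⊗ :0 :⊗ V 0)) :0 refl) ⟩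
      ℕtoℚ M · ∂value (suc M) ⊕ zeroH
    ≈⟨ ⊕-identityʳ _ ⟩
      ℕtoℚ M · ∂value (suc M)
    ≈⟨ ·-cong (ℕtoℚ M) (≋-trans (⊕-cong (∂-x (suc M)) (δ-x (suc M))) (⊕-identityʳ _)) ⟨
      ℕtoℚ M · (∂ (suc M) x ⊕ δ (suc M) x)
    ∎
    where open ≋-Reasoning

  sum-y : sumFrom1 M summand y ≋ ℕtoℚ M · (∂ (suc M) y ⊕ δ (suc M) y)
  sum-y = begin
      sumFrom1 M summand y
    ≈⟨ sumFrom1-telescope M summand y Ty summand-y ⟩
      ((- 1ℚ) · xTerm 0 M ⊖ yTerm M 0) ⊖ ((- 1ℚ) · xTerm M (M ∸ M) ⊖ yTerm (M ∸ M) M)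
    ≡⟨ cong (λ k → ((- 1ℚ) · xTerm 0 M ⊖ yTerm M 0) ⊖ ((- 1ℚ) · xTerm M k ⊖ yTerm k M)) (ℕ.n∸n≡0 M) ⟩
      ((- 1ℚ) · xTerm 0 M ⊖ yTerm M 0) ⊖ ((- 1ℚ) · xTerm M 0 ⊖ yTerm 0 M)
    ≈⟨ ⊕-cong (⊕-cong (·-cong (- 1ℚ) (sandwich-insertions y S x M)) (≋-refl {(- 1ℚ) · yTerm M 0}))
              (·-cong (- 1ℚ) (⊕-cong (≋-refl {(- 1ℚ) · xTerm M 0}) (·-cong (- 1ℚ) (sandwich-insertions y x S M)))) ⟩
      ((- 1ℚ) · P ⊖ y ⊗ zeroH ⊗ S) ⊖ ((- 1ℚ) · (y ⊗ zeroH ⊗ x) ⊖ Q)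
    ≈⟨ prove (x ∷ y ∷ P ∷ Q ∷ [])
             (((- 1ℚ) :· V 2 :⊖ V 1 :⊗ :0 :⊗ (V 0 :⊕ V 1)) :⊖ ((- 1ℚ) :· (V 1 :⊗ :0 :⊗ V 0) :⊖ V 3))
             ((- 1ℚ) :· V 2 :⊕ V 3) refl ⟩
      (- 1ℚ) · P ⊕ Q
    ≈⟨ ⊕-cong (·-comm (ℕtoℚ M) (- 1ℚ) (∂value (suc M))) (≋-refl {Q}) ⟨
      ℕtoℚ M · ((- 1ℚ) · ∂value (suc M)) ⊕ Q
    ≈⟨ ·-distribˡ (ℕtoℚ M) ((- 1ℚ) · ∂value (suc M)) (δvalue (suc M)) ⟨
      ℕtoℚ M · ((- 1ℚ) · ∂value (suc M) ⊕ δvalue (suc M))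
    ≈⟨ ·-cong (ℕtoℚ M) (⊕-cong (∂-y (suc M)) (δ-y (suc M))) ⟨
      ℕtoℚ M · (∂ (suc M) y ⊕ δ (suc M) y)
    ∎
    where
    open ≋-Reasoning
    P Q : H
    P = ℕtoℚ M · ∂value (suc M)
    Q = ℕtoℚ M · δvalue (suc M)

lemma5p2 : (m : ℕ) → 1 ≤ m → (p : H) →
    sumFrom1 (m ∸ 1) (λ j → ⟦ δ j , ∂ (m ∸ j) ⟧) p
      ≈ ℕtoℚ (m ∸ 1) · (∂ m p ⊕ δ m p)
lemma5p2 zero    ()  p
lemma5p2 (suc M) _   p = coeff-≡ (derivation-ext lhs rhs (sum-x M) (sum-y M) p)
  where
  lhs : IsDerivation (sumFrom1 M (summand M))
  lhs = sumFrom1-isDerivation M (summand M)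
          (λ j → commutator-isDerivation (δ-isDerivation j) (∂-isDerivation (suc M ∸ j)))

  rhs : IsDerivation (λ q → ℕtoℚ M · (∂ (suc M) q ⊕ δ (suc M) q))
  rhs = ·-isDerivation (ℕtoℚ M) (⊕-isDerivation (∂-isDerivation (suc M)) (δ-isDerivation (suc M)))
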